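{- For every positive integer $m$, the graphs $\Theta_{3,2,5}\times K_m$ and $H_2\times K_{m-1}$ have the same Laplacian spectrum, where $H_2=2K_1\times(P_4+K_1)$.
   Context: All graphs are finite, simple, undirected. $\Theta_{3,2,5}$ denotes the 6-vertex graph formed by a cycle $C_3$ and a cycle $C_5$ whose intersection is exactly one common edge. The Laplacian spectrum of a graph is the multiset of eigenvalues of $L(G)=D(G)-A(G)$ ($A$ adjacency matrix, $D$ diagonal degree matrix). $G_1+G_2$ is the disjoint union, $mG$ the disjoint union of $m$ copies of $G$, and $G_1\times G_2$ is the disjoint union together with all edges between $VG_1$ and $VG_2$ (the join). $K_m$ is the complete graph on $m$ vertices, $P_4$ the path on 4 vertices; $H_2\times K_0$ is understood as $H_2$. -}

module Defs where

open import Data.Bool using (Bool; true; false; if_then_else_; _∧_; _∨_; not)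
open import Data.Nat using (ℕ; zero; suc; _+_)
open import Data.Integer as ℤ using (ℤ; +_; -_)
open import Data.Fin using (Fin; zero; suc; toℕ; splitAt; punchIn; _≟_)
open import Data.Sum using (inj₁; inj₂)
open import Data.List using (List; []; _∷_; map)
open import Relation.Nullary.Decidable using (⌊_⌋)
open import Relation.Binary.PropositionalEquality using (_≡_; refl) renaming (sym to ≡sym)
open import Relation.Nullary using (yes; no)
open import Data.Empty using (⊥-elim)
open import Data.Product using (_×_)
open import Data.Bool.Properties using (∨-comm)

record Graph : Set where
  field
    n   : ℕ
    adj : Fin n → Fin n → Bool
    sym : ∀ i j → adj i j ≡ adj j i
    irr : ∀ i → adj i i ≡ false
open Graph public

_⊕_ : Graph → Graph → Graph
G ⊕ H = record { n = n G + n H ; adj = a ; sym = s ; irr = r }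
  where
  a : Fin (n G + n H) → Fin (n G + n H) → Bool
  a i j with splitAt (n G) i | splitAt (n G) j
  ... | inj₁ x | inj₁ y = adj G x y
  ... | inj₂ x | inj₂ y = adj H x y
  ... | inj₁ _ | inj₂ _ = false
  ... | inj₂ _ | inj₁ _ = false
  s : ∀ i j → a i j ≡ a j i
  s i j with splitAt (n G) i | splitAt (n G) j
  ... | inj₁ x | inj₁ y = sym G x y
  ... | inj₂ x | inj₂ y = sym H x y
  ... | inj₁ _ | inj₂ _ = refl
  ... | inj₂ _ | inj₁ _ = refl
  r : ∀ i → a i i ≡ false
  r i with splitAt (n G) i
  ... | inj₁ x = irr G x
  ... | inj₂ x = irr H x

-- Join G₁ × G₂: disjoint union plus all edges between VG₁ and VG₂.
_⊗_ : Graph → Graph → Graph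
G ⊗ H = record { n = n G + n H ; adj = a ; sym = s ; irr = r }
  where
  a : Fin (n G + n H) → Fin (n G + n H) → Bool
  a i j with splitAt (n G) i | splitAt (n G) j
  ... | inj₁ x | inj₁ y = adj G x y
  ... | inj₂ x | inj₂ y = adj H x y
  ... | inj₁ _ | inj₂ _ = true
  ... | inj₂ _ | inj₁ _ = true
  s : ∀ i j → a i j ≡ a j i
  s i j with splitAt (n G) i | splitAt (n G) j
  ... | inj₁ x | inj₁ y = sym G x y
  ... | inj₂ x | inj₂ y = sym H x y
  ... | inj₁ _ | inj₂ _ = refl
  ... | inj₂ _ | inj₁ _ = refl
  r : ∀ i → a i i ≡ false
  r i with splitAt (n G) i
  ... | inj₁ x = irr G x
  ... | inj₂ x = irr H x

K : ℕ → Graph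
K m = record { n = m ; adj = λ i j → not ⌊ i ≟ j ⌋ ; sym = s ; irr = r }
  where
  s : ∀ (i j : Fin m) → not ⌊ i ≟ j ⌋ ≡ not ⌊ j ≟ i ⌋
  s i j with i ≟ j | j ≟ i
  ... | yes _ | yes _ = refl
  ... | no _  | no _  = refl
  ... | yes p | no q  = ⊥-elim (q (≡sym p))
  ... | no q  | yes p = ⊥-elim (q (≡sym p))
  r : ∀ (i : Fin m) → not ⌊ i ≟ i ⌋ ≡ false
  r i with i ≟ i
  ... | yes _ = refl
  ... | no q = ⊥-elim (q refl)

P4adj : Fin 4 → Fin 4 → Bool
P4adj zero (suc zero) = true
P4adj (suc zero) zero = true
P4adj (suc zero) (suc (suc zero)) = true
P4adj (suc (suc zero)) (suc zero) = true
P4adj (suc (suc zero)) (suc (suc (suc zero))) = true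
P4adj (suc (suc (suc zero))) (suc (suc zero)) = true
P4adj _ _ = false

P4 : Graph
P4 = record { n = 4 ; adj = P4adj ; sym = s ; irr = r }
  where
  s : ∀ i j → P4adj i j ≡ P4adj j i
  s zero zero = refl
  s zero (suc zero) = refl
  s zero (suc (suc zero)) = refl
  s zero (suc (suc (suc zero))) = refl
  s (suc zero) zero = refl
  s (suc zero) (suc zero) = refl
  s (suc zero) (suc (suc zero)) = refl
  s (suc zero) (suc (suc (suc zero))) = refl
  s (suc (suc zero)) zero = refl
  s (suc (suc zero)) (suc zero) = refl
  s (suc (suc zero)) (suc (suc zero)) = refl
  s (suc (suc zero)) (suc (suc (suc zero))) = refl
  s (suc (suc (suc zero))) zero = refl
  s (suc (suc (suc zero))) (suc zero) = refl
  s (suc (suc (suc zero))) (suc (suc zero)) = refl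
  s (suc (suc (suc zero))) (suc (suc (suc zero))) = refl
  r : ∀ i → P4adj i i ≡ false
  r zero = refl
  r (suc zero) = refl
  r (suc (suc zero)) = refl
  r (suc (suc (suc zero))) = refl

-- Θ_{3,2,5}: vertices 0..5; C₃ = 0-1-2-0 and C₅ = 0-1-3-4-5-0,
-- sharing exactly the edge {0,1}.  Edges: 01,12,20,13,34,45,50.
edgeΘ : ℕ → ℕ → Bool
edgeΘ 0 1 = true
edgeΘ 1 2 = true
edgeΘ 0 2 = true
edgeΘ 1 3 = true
edgeΘ 3 4 = true
edgeΘ 4 5 = true
edgeΘ 0 5 = true
edgeΘ _ _ = false

Θadj : Fin 6 → Fin 6 → Bool
Θadj i j = edgeΘ (toℕ i) (toℕ j) ∨ edgeΘ (toℕ j) (toℕ i)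

Θ325 : Graph
Θ325 = record { n = 6 ; adj = Θadj ; sym = s ; irr = r }
  where
  s : ∀ i j → Θadj i j ≡ Θadj j i
  s i j = ∨-comm (edgeΘ (toℕ i) (toℕ j)) (edgeΘ (toℕ j) (toℕ i))
  r : ∀ i → Θadj i i ≡ false
  r zero = refl
  r (suc zero) = refl
  r (suc (suc zero)) = refl
  r (suc (suc (suc zero))) = refl
  r (suc (suc (suc (suc zero)))) = refl
  r (suc (suc (suc (suc (suc zero))))) = refl

H2 : Graph
H2 = (K 1 ⊕ K 1) ⊗ (P4 ⊕ K 1)

-- Polynomials over ℤ as coefficient lists (constant term first);
-- equality is coefficientwise (so trailing zeros are irrelevant).

Poly : Set
Poly = List ℤ

_+P_ : Poly → Poly → Poly
[] +P q = q
(a ∷ p) +P [] = a ∷ p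
(a ∷ p) +P (b ∷ q) = (a ℤ.+ b) ∷ (p +P q)

negP : Poly → Poly
negP = map -_

_*P_ : Poly → Poly → Poly
[] *P q = []
(a ∷ p) *P q = map (a ℤ.*_) q +P (+ 0 ∷ (p *P q))

constP : ℤ → Poly
constP a = a ∷ []

coeff : Poly → ℕ → ℤ
coeff [] _ = + 0
coeff (a ∷ p) zero = a
coeff (a ∷ p) (suc k) = coeff p k

_≈P_ : Poly → Poly → Set
p ≈P q = ∀ k → coeff p k ≡ coeff q k

sumP : ∀ {k} → (Fin k → Poly) → Poly
sumP {zero} f = []
sumP {suc k} f = f zero +P sumP (λ j → f (suc j))

signP : ℕ → Poly → Poly
signP zero p = p
signP (suc k) p = negP (signP k p)

det : ∀ {k} → (Fin k → Fin k → Poly) → Poly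
det {zero} M = constP (+ 1)
det {suc k} M =
  sumP (λ j → signP (toℕ j) (M zero j *P det (λ r c → M (suc r) (punchIn j c))))

count : ∀ {k} → (Fin k → Bool) → ℕ
count {zero} f = 0
count {suc k} f = (if f zero then 1 else 0) + count (λ j → f (suc j))

degree : (G : Graph) → Fin (n G) → ℕ
degree G i = count (adj G i)

laplacian : (G : Graph) → Fin (n G) → Fin (n G) → ℤ
laplacian G i j =
  if ⌊ i ≟ j ⌋ then + degree G i
  else (if adj G i j then - (+ 1) else + 0)

lapCharPoly : Graph → Poly
lapCharPoly G =
  det (λ i j → if ⌊ i ≟ j ⌋ then (- laplacian G i j) ∷ (+ 1) ∷ []
               else constP (- laplacian G i j))

-- Same Laplacian spectrum: same number of vertices and equal Laplacian
-- characteristic polynomials (L(G) is a real symmetric matrix, so its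
-- spectrum is exactly the multiset of roots of this polynomial).
LaplacianCospectral : Graph → Graph → Set
LaplacianCospectral G H = (n G ≡ n H) × (lapCharPoly G ≈P lapCharPoly H)

-- Write χ G for the Laplacian characteristic polynomial det (x·I − L(G)) of a graph G on n vertices.
-- Subtracting adjacent columns of x·I − L(G × K m) (m ≥ 1) makes it block triangular, which gives
--   χ (G × K m) (x) = χ G (x − m) · γ ^ m + β G (x − m) · m · γ ^ (m − 1),   γ = x − m − n,
-- where β G is the determinant of the adjacent column differences of [x·I − L(G) | 𝟙].
-- So the Laplacian spectrum of G × K m is determined by n, χ G and β G. Since
-- Θ₃,₂,₅ × K m = (Θ₃,₂,₅ × K₁) × K (m − 1), it suffices that the 7-vertex graphs Θ₃,₂,₅ × K₁ and H₂
-- have the same χ and β, which is a finite computation, as is the case m = 1.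

module Submission where

open import Defs hiding (sym)
open import Algebra.Bundles using (CommutativeRing; Semiring)
open import Algebra.Morphism.Structures using (module RingMorphisms)
open import Data.Bool using (Bool; true; false; _∧_; not; if_then_else_)
open import Data.Empty using (⊥-elim)
open import Data.Fin as Fin using (Fin; zero; suc; toℕ; fromℕ<; punchIn; punchOut; splitAt; cast; _↑ˡ_; _↑ʳ_)
open import Data.Fin.Properties
  using ( punchIn-punchOut; punchIn-injective; punchInᵢ≢i; toℕ-injective; toℕ<n; toℕ-fromℕ<; toℕ-↑ˡ; toℕ-↑ʳ
        ; splitAt-↑ˡ; splitAt-↑ʳ; splitAt⁻¹-↑ˡ; splitAt⁻¹-↑ʳ; toℕ-cast; cast-is-id; ↑ˡ-injective; ↑ʳ-injective; suc-injective)
open import Data.Integer as ℤ using (ℤ; +_; -_; _-_) renaming (_+_ to _+ℤ_; _*_ to _*ℤ_)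
import Data.Integer.Properties as ℤ
open import Data.Integer.Tactic.RingSolver using (solve-∀)
open import Data.List using ([]; _∷_; map)
open import Data.Nat as ℕ using (ℕ; zero; suc; pred; _≤_; _<_; _<?_; _∸_; z≤n; s≤s)
import Data.Nat.Properties as ℕ
open import Data.Product using (_×_; _,_)
open import Data.Sum using (_⊎_; inj₁; inj₂; [_,_]′)
open import Function using (_∘_)
open import Relation.Binary.Definitions using (tri<; tri≈; tri>)
open import Relation.Binary.PropositionalEquality as ≡ using (_≡_; _≢_; refl; cong; cong₂; subst; subst₂)
open import Relation.Nullary using (Dec; does; ¬_; yes; no)
open import Relation.Nullary.Decidable using (⌊_⌋; dec-true; dec-false)

-- Polynomials

infix 4 _≈_
record _≈_ (p q : Poly) : Set where
  constructor coeffwise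
  field coeff-≡ : ∀ k → coeff p k ≡ coeff q k
open _≈_ public

0P 1P : Poly
0P = []
1P = constP (+ 1)

≈-refl : ∀ {p} → p ≈ p
≈-refl = coeffwise λ _ → refl

≈-sym : ∀ {p q} → p ≈ q → q ≈ p
≈-sym e = coeffwise λ k → ≡.sym (coeff-≡ e k)

≈-trans : ∀ {p q r} → p ≈ q → q ≈ r → p ≈ r
≈-trans e f = coeffwise λ k → ≡.trans (coeff-≡ e k) (coeff-≡ f k)

≈-reflexive : ∀ {p q} → p ≡ q → p ≈ q
≈-reflexive refl = ≈-refl

∷-cong : ∀ {a b p q} → a ≡ b → p ≈ q → a ∷ p ≈ b ∷ q
∷-cong a≡b p≈q = coeffwise λ { zero → a≡b ; (suc k) → coeff-≡ p≈q k }

∷-injective : ∀ {a b p q} → a ∷ p ≈ b ∷ q → a ≡ b × p ≈ q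
∷-injective e = coeff-≡ e 0 , coeffwise λ k → coeff-≡ e (suc k)

∷-zero : ∀ {a p} → a ∷ p ≈ 0P → a ≡ + 0 × p ≈ 0P
∷-zero e = coeff-≡ e 0 , coeffwise λ k → coeff-≡ e (suc k)

coeff-+P : ∀ p q k → coeff (p +P q) k ≡ coeff p k +ℤ coeff q k
coeff-+P []      q       k       = ≡.sym (ℤ.+-identityˡ _)
coeff-+P (a ∷ p) []      k       = ≡.sym (ℤ.+-identityʳ _)
coeff-+P (a ∷ p) (b ∷ q) zero    = refl
coeff-+P (a ∷ p) (b ∷ q) (suc k) = coeff-+P p q k

coeff-negP : ∀ p k → coeff (negP p) k ≡ - coeff p k
coeff-negP []      k       = refl
coeff-negP (a ∷ p) zero    = refl
coeff-negP (a ∷ p) (suc k) = coeff-negP p k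

coeff-scale : ∀ a q k → coeff (map (a *ℤ_) q) k ≡ a *ℤ coeff q k
coeff-scale a []      k       = ≡.sym (ℤ.*-zeroʳ a)
coeff-scale a (b ∷ q) zero    = refl
coeff-scale a (b ∷ q) (suc k) = coeff-scale a q k

+P-cong : ∀ {p p′ q q′} → p ≈ p′ → q ≈ q′ → p +P q ≈ p′ +P q′
+P-cong {p} {p′} {q} {q′} e f = coeffwise λ k → begin
  coeff (p +P q) k          ≡⟨ coeff-+P p q k ⟩
  coeff p k +ℤ coeff q k    ≡⟨ cong₂ _+ℤ_ (coeff-≡ e k) (coeff-≡ f k) ⟩
  coeff p′ k +ℤ coeff q′ k  ≡⟨ coeff-+P p′ q′ k ⟨
  coeff (p′ +P q′) k        ∎
  where open ≡.≡-Reasoning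

negP-cong : ∀ {p q} → p ≈ q → negP p ≈ negP q
negP-cong {p} {q} e = coeffwise λ k → begin
  coeff (negP p) k  ≡⟨ coeff-negP p k ⟩
  - coeff p k       ≡⟨ cong -_ (coeff-≡ e k) ⟩
  - coeff q k       ≡⟨ coeff-negP q k ⟨
  coeff (negP q) k  ∎
  where open ≡.≡-Reasoning

+P-comm : ∀ p q → p +P q ≈ q +P p
+P-comm p q = coeffwise λ k → begin
  coeff (p +P q) k        ≡⟨ coeff-+P p q k ⟩
  coeff p k +ℤ coeff q k  ≡⟨ ℤ.+-comm (coeff p k) _ ⟩
  coeff q k +ℤ coeff p k  ≡⟨ coeff-+P q p k ⟨
  coeff (q +P p) k        ∎
  where open ≡.≡-Reasoning

+P-assoc : ∀ p q r → (p +P q) +P r ≈ p +P (q +P r)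
+P-assoc p q r = coeffwise λ k → begin
  coeff ((p +P q) +P r) k                ≡⟨ coeff-+P (p +P q) r k ⟩
  coeff (p +P q) k +ℤ coeff r k          ≡⟨ cong (_+ℤ coeff r k) (coeff-+P p q k) ⟩
  (coeff p k +ℤ coeff q k) +ℤ coeff r k  ≡⟨ ℤ.+-assoc (coeff p k) _ _ ⟩
  coeff p k +ℤ (coeff q k +ℤ coeff r k)  ≡⟨ cong (coeff p k +ℤ_) (coeff-+P q r k) ⟨
  coeff p k +ℤ coeff (q +P r) k          ≡⟨ coeff-+P p (q +P r) k ⟨
  coeff (p +P (q +P r)) k                ∎
  where open ≡.≡-Reasoning

+P-identityʳ : ∀ p → p +P 0P ≈ p
+P-identityʳ p = coeffwise λ k → ≡.trans (coeff-+P p [] k) (ℤ.+-identityʳ _)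

+P-inverseʳ : ∀ p → p +P negP p ≈ 0P
+P-inverseʳ p = coeffwise λ k → begin
  coeff (p +P negP p) k          ≡⟨ coeff-+P p (negP p) k ⟩
  coeff p k +ℤ coeff (negP p) k  ≡⟨ cong (coeff p k +ℤ_) (coeff-negP p k) ⟩
  coeff p k - coeff p k          ≡⟨ ℤ.+-inverseʳ (coeff p k) ⟩
  + 0                            ∎
  where open ≡.≡-Reasoning

+P-inverseˡ : ∀ p → negP p +P p ≈ 0P
+P-inverseˡ p = ≈-trans (+P-comm (negP p) p) (+P-inverseʳ p)

+P-congˡ : ∀ {p q q′} → q ≈ q′ → p +P q ≈ p +P q′
+P-congˡ = +P-cong ≈-refl

+P-swap : ∀ p q r → p +P (q +P r) ≈ q +P (p +P r)
+P-swap p q r = ≈-trans (≈-sym (+P-assoc p q r))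
                (≈-trans (+P-cong (+P-comm p q) ≈-refl) (+P-assoc q p r))

+P-interchange : ∀ p q r s → (p +P q) +P (r +P s) ≈ (p +P r) +P (q +P s)
+P-interchange p q r s = ≈-trans (+P-assoc p q (r +P s))
  (≈-trans (+P-cong (≈-refl {p}) (+P-swap q r s)) (≈-sym (+P-assoc p r (q +P s))))

scale : ℤ → Poly → Poly
scale a = map (a *ℤ_)

scale-cong : ∀ a {q q′} → q ≈ q′ → scale a q ≈ scale a q′
scale-cong a {q} {q′} e = coeffwise λ k → begin
  coeff (scale a q) k   ≡⟨ coeff-scale a q k ⟩
  a *ℤ coeff q k        ≡⟨ cong (a *ℤ_) (coeff-≡ e k) ⟩
  a *ℤ coeff q′ k       ≡⟨ coeff-scale a q′ k ⟨
  coeff (scale a q′) k  ∎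
  where open ≡.≡-Reasoning

scale-zero : ∀ q → scale (+ 0) q ≈ 0P
scale-zero q = coeffwise λ k → coeff-scale (+ 0) q k

scale-one : ∀ q → scale (+ 1) q ≈ q
scale-one q = coeffwise λ k → ≡.trans (coeff-scale (+ 1) q k) (ℤ.*-identityˡ _)

scale-distribʳ : ∀ a b q → scale (a +ℤ b) q ≈ scale a q +P scale b q
scale-distribʳ a b q = coeffwise λ k → begin
  coeff (scale (a +ℤ b) q) k                  ≡⟨ coeff-scale (a +ℤ b) q k ⟩
  (a +ℤ b) *ℤ coeff q k                       ≡⟨ ℤ.*-distribʳ-+ (coeff q k) a b ⟩
  a *ℤ coeff q k +ℤ b *ℤ coeff q k            ≡⟨ cong₂ _+ℤ_ (coeff-scale a q k) (coeff-scale b q k) ⟨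
  coeff (scale a q) k +ℤ coeff (scale b q) k  ≡⟨ coeff-+P (scale a q) (scale b q) k ⟨
  coeff (scale a q +P scale b q) k            ∎
  where open ≡.≡-Reasoning

scale-distribˡ : ∀ a p q → scale a (p +P q) ≈ scale a p +P scale a q
scale-distribˡ a p q = coeffwise λ k → begin
  coeff (scale a (p +P q)) k                  ≡⟨ coeff-scale a (p +P q) k ⟩
  a *ℤ coeff (p +P q) k                       ≡⟨ cong (a *ℤ_) (coeff-+P p q k) ⟩
  a *ℤ (coeff p k +ℤ coeff q k)               ≡⟨ ℤ.*-distribˡ-+ a (coeff p k) _ ⟩
  a *ℤ coeff p k +ℤ a *ℤ coeff q k            ≡⟨ cong₂ _+ℤ_ (coeff-scale a p k) (coeff-scale a q k) ⟨
  coeff (scale a p) k +ℤ coeff (scale a q) k  ≡⟨ coeff-+P (scale a p) (scale a q) k ⟨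
  coeff (scale a p +P scale a q) k            ∎
  where open ≡.≡-Reasoning

scale-scale : ∀ a b q → scale a (scale b q) ≈ scale (a *ℤ b) q
scale-scale a b q = coeffwise λ k → begin
  coeff (scale a (scale b q)) k  ≡⟨ coeff-scale a (scale b q) k ⟩
  a *ℤ coeff (scale b q) k       ≡⟨ cong (a *ℤ_) (coeff-scale b q k) ⟩
  a *ℤ (b *ℤ coeff q k)          ≡⟨ ℤ.*-assoc a b _ ⟨
  a *ℤ b *ℤ coeff q k            ≡⟨ coeff-scale (a *ℤ b) q k ⟨
  coeff (scale (a *ℤ b) q) k     ∎
  where open ≡.≡-Reasoning

shift-zero : ∀ {p} → p ≈ 0P → + 0 ∷ p ≈ 0P
shift-zero e = coeffwise λ { zero → refl ; (suc k) → coeff-≡ e k }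

*P-zeroʳ : ∀ p → p *P 0P ≈ 0P
*P-zeroʳ []      = ≈-refl
*P-zeroʳ (a ∷ p) = shift-zero (*P-zeroʳ p)

*P-zeroˡ-≈ : ∀ {p} q → p ≈ 0P → p *P q ≈ 0P
*P-zeroˡ-≈ {[]}    q e = ≈-refl
*P-zeroˡ-≈ {a ∷ p} q e with ∷-zero e
... | refl , p≈0 = ≈-trans (+P-cong (scale-zero q) ≈-refl) (shift-zero (*P-zeroˡ-≈ q p≈0))

*P-congˡ : ∀ {p p′} q → p ≈ p′ → p *P q ≈ p′ *P q
*P-congˡ {[]}    {p′}     q e = ≈-sym (*P-zeroˡ-≈ q (≈-sym e))
*P-congˡ {a ∷ p} {[]}     q e = *P-zeroˡ-≈ q e
*P-congˡ {a ∷ p} {b ∷ p′} q e with ∷-injective e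
... | refl , p≈p′ = +P-cong ≈-refl (∷-cong refl (*P-congˡ q p≈p′))

*P-congʳ : ∀ p {q q′} → q ≈ q′ → p *P q ≈ p *P q′
*P-congʳ []      e = ≈-refl
*P-congʳ (a ∷ p) e = +P-cong (scale-cong a e) (∷-cong refl (*P-congʳ p e))

*P-cong : ∀ {p p′ q q′} → p ≈ p′ → q ≈ q′ → p *P q ≈ p′ *P q′
*P-cong {p′ = p′} {q} e f = ≈-trans (*P-congˡ q e) (*P-congʳ p′ f)

*P-∷ʳ : ∀ q a p → q *P (a ∷ p) ≈ scale a q +P (+ 0 ∷ (q *P p))
*P-∷ʳ []      a p = ≈-sym (shift-zero ≈-refl)
*P-∷ʳ (b ∷ q) a p = ∷-cong (cong (_+ℤ + 0) (ℤ.*-comm b a))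
  (≈-trans (+P-cong ≈-refl (*P-∷ʳ q a p)) (+P-swap (scale b p) (scale a q) _))

*P-comm : ∀ p q → p *P q ≈ q *P p
*P-comm []      q = ≈-sym (*P-zeroʳ q)
*P-comm (a ∷ p) q = ≈-trans (+P-cong ≈-refl (∷-cong refl (*P-comm p q))) (≈-sym (*P-∷ʳ q a p))

*P-distribʳ : ∀ p p′ q → (p +P p′) *P q ≈ (p *P q) +P (p′ *P q)
*P-distribʳ []      p′       q = ≈-refl
*P-distribʳ (a ∷ p) []       q = ≈-sym (+P-identityʳ _)
*P-distribʳ (a ∷ p) (b ∷ p′) q =
  ≈-trans (+P-cong (scale-distribʳ a b q) (∷-cong refl (*P-distribʳ p p′ q)))
          (+P-interchange (scale a q) (scale b q) (+ 0 ∷ (p *P q)) (+ 0 ∷ (p′ *P q)))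

scale-*P : ∀ a q r → scale a q *P r ≈ scale a (q *P r)
scale-*P a []      r = ≈-refl
scale-*P a (b ∷ q) r = ≈-sym (≈-trans (scale-distribˡ a (scale b r) (+ 0 ∷ (q *P r)))
  (+P-cong (scale-scale a b r) (∷-cong (ℤ.*-zeroʳ a) (≈-sym (scale-*P a q r)))))

shift-*P : ∀ p q → (+ 0 ∷ p) *P q ≈ + 0 ∷ (p *P q)
shift-*P p q = +P-cong (scale-zero q) ≈-refl

*P-assoc : ∀ p q r → (p *P q) *P r ≈ p *P (q *P r)
*P-assoc []      q r = ≈-refl
*P-assoc (a ∷ p) q r = ≈-trans (*P-distribʳ (scale a q) (+ 0 ∷ (p *P q)) r)
  (+P-cong (scale-*P a q r) (≈-trans (shift-*P (p *P q) r) (∷-cong refl (*P-assoc p q r))))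

*P-identityˡ : ∀ p → 1P *P p ≈ p
*P-identityˡ p = ≈-trans (+P-cong (scale-one p) (shift-zero ≈-refl)) (+P-identityʳ p)

polyCommutativeRing : CommutativeRing _ _
polyCommutativeRing = record
  { Carrier = Poly ; _≈_ = _≈_ ; _+_ = _+P_ ; _*_ = _*P_ ; -_ = negP ; 0# = 0P ; 1# = 1P
  ; isCommutativeRing = record
    { isRing = record
      { +-isAbelianGroup = record
        { isGroup = record
          { isMonoid = record
            { isSemigroup = record
              { isMagma = record
                { isEquivalence = record { refl = ≈-refl ; sym = ≈-sym ; trans = ≈-trans }
                ; ∙-cong = +P-cong }
              ; assoc = +P-assoc }
            ; identity = (λ _ → ≈-refl) , +P-identityʳ }
          ; inverse = +P-inverseˡ , +P-inverseʳ
          ; ⁻¹-cong = negP-cong }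
        ; comm = +P-comm }
      ; *-cong = *P-cong
      ; *-assoc = *P-assoc
      ; *-identity = *P-identityˡ , (λ p → ≈-trans (*P-comm p 1P) (*P-identityˡ p))
      ; distrib = (λ p q q′ → ≈-trans (*P-comm p (q +P q′)) (≈-trans (*P-distribʳ q q′ p)
                                 (+P-cong (*P-comm q p) (*P-comm q′ p))))
                , (λ q p p′ → *P-distribʳ p p′ q) }
    ; *-comm = *P-comm } }

open CommutativeRing polyCommutativeRing using (setoid; ring; rawRing; semiring; distribˡ; distribʳ)
open import Algebra.Properties.Ring ring using (-‿distribˡ-*; -‿distribʳ-*; -‿+-comm; -‿involutive)
open import Algebra.Definitions.RawSemiring (Semiring.rawSemiring semiring) using (_^_) renaming (_×_ to _·_)
open import Algebra.Properties.Semiring.Mult semiring using (×-comm-*)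
open import Relation.Binary.Reasoning.Setoid setoid

constP-*P : ∀ a q → constP a *P q ≈ scale a q
constP-*P a q = ≈-trans (+P-congˡ (shift-zero ≈-refl)) (+P-identityʳ (scale a q))

-- translate t p is p(x − t), computed by Horner's scheme.
x-minus : ℤ → Poly
x-minus t = (- t) ∷ (+ 1) ∷ []

translate : ℤ → Poly → Poly
translate t []      = []
translate t (a ∷ p) = constP a +P (x-minus t *P translate t p)

translate-zero : ∀ t {p} → p ≈ 0P → translate t p ≈ 0P
translate-zero t {[]}    e = ≈-refl
translate-zero t {a ∷ p} e with ∷-zero e
... | refl , p≈0 = ≈-trans (+P-cong (shift-zero ≈-refl) (≈-trans (*P-congʳ (x-minus t) (translate-zero t p≈0))
                                                             (*P-zeroʳ (x-minus t))))
                           (+P-identityʳ 0P)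

translate-cong : ∀ t {p q} → p ≈ q → translate t p ≈ translate t q
translate-cong t {[]}    {q}     e = ≈-sym (translate-zero t (≈-sym e))
translate-cong t {a ∷ p} {[]}    e = translate-zero t e
translate-cong t {a ∷ p} {b ∷ q} e with ∷-injective e
... | refl , p≈q = +P-congˡ {constP a} (*P-congʳ (x-minus t) (translate-cong t p≈q))

translate-+P : ∀ t p q → translate t (p +P q) ≈ translate t p +P translate t q
translate-+P t []      q       = ≈-refl
translate-+P t (a ∷ p) []      = ≈-sym (+P-identityʳ _)
translate-+P t (a ∷ p) (b ∷ q) = begin
  constP (a +ℤ b) +P (x-minus t *P translate t (p +P q))
    ≈⟨ +P-congˡ {constP (a +ℤ b)} (≈-trans (*P-congʳ (x-minus t) (translate-+P t p q))
                                            (distribˡ (x-minus t) (translate t p) (translate t q))) ⟩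
  (constP a +P constP b) +P ((x-minus t *P translate t p) +P (x-minus t *P translate t q))
    ≈⟨ +P-interchange (constP a) (constP b) (x-minus t *P translate t p) (x-minus t *P translate t q) ⟩
  translate t (a ∷ p) +P translate t (b ∷ q)  ∎

translate-negP : ∀ t p → translate t (negP p) ≈ negP (translate t p)
translate-negP t []      = ≈-refl
translate-negP t (a ∷ p) = begin
  constP (- a) +P (x-minus t *P translate t (negP p))  ≈⟨ +P-congˡ {constP (- a)} (*P-congʳ (x-minus t) (translate-negP t p)) ⟩
  constP (- a) +P (x-minus t *P negP (translate t p))  ≈⟨ +P-congˡ {constP (- a)} (≈-sym (-‿distribʳ-* (x-minus t) (translate t p))) ⟩
  negP (constP a) +P negP (x-minus t *P translate t p) ≈⟨ -‿+-comm (constP a) (x-minus t *P translate t p) ⟩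
  negP (translate t (a ∷ p))                            ∎

translate-scale : ∀ t a q → translate t (scale a q) ≈ constP a *P translate t q
translate-scale t a []      = ≈-sym (*P-zeroʳ (constP a))
translate-scale t a (b ∷ q) = begin
  constP (a *ℤ b) +P (x-minus t *P translate t (scale a q))
    ≈⟨ +P-cong (≈-sym (constP-*P a (constP b))) (*P-congʳ (x-minus t) (translate-scale t a q)) ⟩
  (constP a *P constP b) +P (x-minus t *P (constP a *P translate t q))
    ≈⟨ +P-congˡ {constP a *P constP b} (≈-trans (≈-sym (*P-assoc (x-minus t) (constP a) (translate t q)))
               (≈-trans (*P-congˡ _ (*P-comm (x-minus t) (constP a))) (*P-assoc (constP a) (x-minus t) (translate t q)))) ⟩
  (constP a *P constP b) +P (constP a *P (x-minus t *P translate t q))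
    ≈⟨ distribˡ (constP a) (constP b) (x-minus t *P translate t q) ⟨
  constP a *P translate t (b ∷ q)  ∎

translate-*P : ∀ t p q → translate t (p *P q) ≈ translate t p *P translate t q
translate-*P t []      q = ≈-refl
translate-*P t (a ∷ p) q = begin
  translate t (scale a q +P (+ 0 ∷ (p *P q)))
    ≈⟨ translate-+P t (scale a q) (+ 0 ∷ (p *P q)) ⟩
  translate t (scale a q) +P (constP (+ 0) +P (x-minus t *P translate t (p *P q)))
    ≈⟨ +P-cong (translate-scale t a q) (+P-cong (shift-zero ≈-refl) (*P-congʳ (x-minus t) (translate-*P t p q))) ⟩
  (constP a *P translate t q) +P (x-minus t *P (translate t p *P translate t q))
    ≈⟨ +P-congˡ {constP a *P translate t q} (≈-sym (*P-assoc (x-minus t) (translate t p) (translate t q))) ⟩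
  (constP a *P translate t q) +P ((x-minus t *P translate t p) *P translate t q)
    ≈⟨ distribʳ (translate t q) (constP a) (x-minus t *P translate t p) ⟨
  translate t (a ∷ p) *P translate t q  ∎

translate-constP : ∀ t a → translate t (constP a) ≈ constP a
translate-constP t a = ≈-trans (+P-congˡ {constP a} (*P-zeroʳ (x-minus t))) (+P-identityʳ (constP a))

translate-isRingHomomorphism : ∀ t → RingMorphisms.IsRingHomomorphism rawRing rawRing (translate t)
translate-isRingHomomorphism t = record
  { isSemiringHomomorphism = record
    { isNearSemiringHomomorphism = record
      { +-isMonoidHomomorphism = record
        { isMagmaHomomorphism = record
          { isRelHomomorphism = record { cong = translate-cong t }
          ; homo = translate-+P t }
        ; ε-homo = ≈-refl }
      ; *-homo = translate-*P t }
    ; 1#-homo = translate-constP t (+ 1) }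
  ; -‿homo = translate-negP t }

translate-monic-linear : ∀ t c → translate t (c ∷ (+ 1) ∷ []) ≈ (c - t) ∷ (+ 1) ∷ []
translate-monic-linear t c = +P-congˡ {constP c} (≈-trans (*P-congʳ (x-minus t) (translate-constP t (+ 1)))
                                             (CommutativeRing.*-identityʳ polyCommutativeRing (x-minus t)))

isZeroP : Poly → Bool
isZeroP []      = true
isZeroP (a ∷ p) = ⌊ a ℤ.≟ + 0 ⌋ ∧ isZeroP p

_==P_ : Poly → Poly → Bool
[]      ==P q       = isZeroP q
(a ∷ p) ==P []      = isZeroP (a ∷ p)
(a ∷ p) ==P (b ∷ q) = ⌊ a ℤ.≟ b ⌋ ∧ (p ==P q)

isZeroP-sound : ∀ p → isZeroP p ≡ true → p ≈ 0P
isZeroP-sound []      _  = ≈-refl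
isZeroP-sound (a ∷ p) ok with a ℤ.≟ + 0
... | yes a≡0 = ≈-trans (∷-cong a≡0 (isZeroP-sound p ok)) (shift-zero ≈-refl)

-- Closed identities are checked by evaluating p ==P q, far cheaper than normalising p and q themselves.
==P-sound : ∀ p q → p ==P q ≡ true → p ≈ q
==P-sound []      q       ok = ≈-sym (isZeroP-sound q ok)
==P-sound (a ∷ p) []      ok = isZeroP-sound (a ∷ p) ok
==P-sound (a ∷ p) (b ∷ q) ok with a ℤ.≟ b
... | yes a≡b = ∷-cong a≡b (==P-sound p q ok)

-- Determinants

Matrix : ℕ → Set
Matrix k = Fin k → Fin k → Poly

minor : ∀ {k} → Matrix (suc k) → Fin (suc k) → Matrix k
minor M j r c = M (suc r) (punchIn j c)

cofactorTerm : ∀ {k} → Matrix (suc k) → Fin (suc k) → Poly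
cofactorTerm M j = signP (toℕ j) (M zero j *P det (minor M j))

sum-cong : ∀ {k} {f g : Fin k → Poly} → (∀ j → f j ≈ g j) → sumP f ≈ sumP g
sum-cong {zero}  f≈g = ≈-refl
sum-cong {suc k} f≈g = +P-cong (f≈g zero) (sum-cong (f≈g ∘ suc))

sum-zero : ∀ {k} (f : Fin k → Poly) → (∀ j → f j ≈ 0P) → sumP f ≈ 0P
sum-zero {zero}  f f≈0 = ≈-refl
sum-zero {suc k} f f≈0 = +P-cong (f≈0 zero) (sum-zero (f ∘ suc) (f≈0 ∘ suc))

sum-+P : ∀ {k} (f g : Fin k → Poly) → sumP (λ j → f j +P g j) ≈ sumP f +P sumP g
sum-+P {zero}  f g = ≈-refl
sum-+P {suc k} f g = ≈-trans (+P-congˡ {f zero +P g zero} (sum-+P (f ∘ suc) (g ∘ suc)))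
                             (+P-interchange (f zero) (g zero) (sumP (f ∘ suc)) (sumP (g ∘ suc)))

sum-*P : ∀ {k} (f : Fin k → Poly) q → sumP (λ j → f j *P q) ≈ sumP f *P q
sum-*P {zero}  f q = ≈-refl
sum-*P {suc k} f q = ≈-trans (+P-congˡ {f zero *P q} (sum-*P (f ∘ suc) q))
                             (≈-sym (*P-distribʳ (f zero) (sumP (f ∘ suc)) q))

sum-homo : ∀ {h} → RingMorphisms.IsRingHomomorphism rawRing rawRing h →
           ∀ {k} (f : Fin k → Poly) → h (sumP f) ≈ sumP (h ∘ f)
sum-homo hom {zero}  f = 0#-homo where open RingMorphisms.IsRingHomomorphism hom
sum-homo hom {suc k} f = ≈-trans (+-homo (f zero) (sumP (f ∘ suc))) (+P-congˡ {_} (sum-homo hom (f ∘ suc)))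
  where open RingMorphisms.IsRingHomomorphism hom

sum-head : ∀ {k} (f : Fin (suc k) → Poly) → (∀ j → f (suc j) ≈ 0P) → sumP f ≈ f zero
sum-head f tail≈0 = ≈-trans (+P-congˡ {f zero} (sum-zero (f ∘ suc) tail≈0)) (+P-identityʳ (f zero))

sum-++ : ∀ a {b} (f : Fin (a ℕ.+ b) → Poly) →
         sumP f ≈ sumP (λ j → f (j ↑ˡ b)) +P sumP (λ j → f (a ↑ʳ j))
sum-++ zero    f = ≈-refl
sum-++ (suc a) f = ≈-trans (+P-congˡ {f zero} (sum-++ a (f ∘ suc))) (≈-sym (+P-assoc (f zero) _ _))

sum-adjacent-pair : ∀ {k} (f : Fin k → Poly) (a b : Fin k) → toℕ b ≡ suc (toℕ a) →
                    (∀ j → j ≢ a → j ≢ b → f j ≈ 0P) → f a +P f b ≈ 0P → sumP f ≈ 0P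
sum-adjacent-pair f zero (suc zero) refl others pair =
  ≈-trans (≈-sym (+P-assoc (f zero) (f (suc zero)) _))
          (+P-cong pair (sum-zero (λ j → f (suc (suc j))) λ j → others (suc (suc j)) (λ ()) (λ ())))
sum-adjacent-pair f (suc a) (suc b) b≡1+a others pair =
  +P-cong (others zero (λ ()) (λ ()))
          (sum-adjacent-pair (f ∘ suc) a b (ℕ.suc-injective b≡1+a)
             (λ j j≢a j≢b → others (suc j) (j≢a ∘ suc-injective) (j≢b ∘ suc-injective)) pair)

signP-cong : ∀ k {p q} → p ≈ q → signP k p ≈ signP k q
signP-cong zero    e = e
signP-cong (suc k) e = negP-cong (signP-cong k e)

signP-zero : ∀ k {p} → p ≈ 0P → signP k p ≈ 0P
signP-zero zero    e = e
signP-zero (suc k) e = negP-cong (signP-zero k e)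

signP-+P : ∀ k p q → signP k (p +P q) ≈ signP k p +P signP k q
signP-+P zero    p q = ≈-refl
signP-+P (suc k) p q = ≈-trans (negP-cong (signP-+P k p q)) (≈-sym (-‿+-comm (signP k p) (signP k q)))

signP-*Pˡ : ∀ k p q → signP k (p *P q) ≈ signP k p *P q
signP-*Pˡ zero    p q = ≈-refl
signP-*Pˡ (suc k) p q = ≈-trans (negP-cong (signP-*Pˡ k p q)) (-‿distribˡ-* (signP k p) q)

signP-homo : ∀ {h} → RingMorphisms.IsRingHomomorphism rawRing rawRing h →
             ∀ k p → h (signP k p) ≈ signP k (h p)
signP-homo hom zero    p = ≈-refl
signP-homo hom (suc k) p = ≈-trans (-‿homo (signP k p)) (negP-cong (signP-homo hom k p))
  where open RingMorphisms.IsRingHomomorphism hom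

det-cong : ∀ {k} {M N : Matrix k} → (∀ r c → M r c ≈ N r c) → det M ≈ det N
det-cong {zero}  M≈N = ≈-refl
det-cong {suc k} M≈N = sum-cong λ j →
  signP-cong (toℕ j) (*P-cong (M≈N zero j) (det-cong λ r c → M≈N (suc r) (punchIn j c)))

det-homo : ∀ {h} → RingMorphisms.IsRingHomomorphism rawRing rawRing h →
           ∀ {k} (M : Matrix k) → det (λ r c → h (M r c)) ≈ h (det M)
det-homo hom {zero}  M = ≈-sym 1#-homo
  where open RingMorphisms.IsRingHomomorphism hom
det-homo {h} hom {suc k} M = ≈-trans (sum-cong term) (≈-sym (sum-homo hom (cofactorTerm M)))
  where
  open RingMorphisms.IsRingHomomorphism hom
  term : ∀ j → cofactorTerm (λ r c → h (M r c)) j ≈ h (cofactorTerm M j)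
  term j = ≈-trans (signP-cong (toℕ j) (≈-trans (*P-congʳ (h (M zero j)) (det-homo hom (minor M j)))
                                                (≈-sym (*-homo (M zero j) (det (minor M j))))))
                   (≈-sym (signP-homo hom (toℕ j) _))

det-zero-column : ∀ {k} (M : Matrix k) (t : Fin k) → (∀ r → M r t ≈ 0P) → det M ≈ 0P
minor-zero-column : ∀ {k} (M : Matrix (suc k)) j t → j ≢ t → (∀ r → M (suc r) t ≈ 0P) → det (minor M j) ≈ 0P

det-zero-column {suc k} M t col≈0 = sum-zero (cofactorTerm M) term
  where
  term : ∀ j → cofactorTerm M j ≈ 0P
  term j with j Fin.≟ t
  ... | yes refl = signP-zero (toℕ j) (*P-zeroˡ-≈ _ (col≈0 zero))
  ... | no j≢t   = signP-zero (toℕ j) (≈-trans (*P-congʳ (M zero j) (minor-zero-column M j t j≢t (col≈0 ∘ suc)))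
                                               (*P-zeroʳ (M zero j)))

minor-zero-column M j t j≢t col≈0 = det-zero-column (minor M j) (punchOut j≢t) λ r →
  subst (λ c → M (suc r) c ≈ 0P) (≡.sym (punchIn-punchOut j≢t)) (col≈0 r)

det-linear-column : ∀ {k} (M N₁ N₂ : Matrix k) (t : Fin k) →
  (∀ r c → c ≢ t → M r c ≈ N₁ r c) → (∀ r c → c ≢ t → M r c ≈ N₂ r c) →
  (∀ r → M r t ≈ N₁ r t +P N₂ r t) → det M ≈ det N₁ +P det N₂
det-linear-column {suc k} M N₁ N₂ t M≈N₁ M≈N₂ column-t =
  ≈-trans (sum-cong term) (sum-+P (cofactorTerm N₁) (cofactorTerm N₂))
  where
  term : ∀ j → cofactorTerm M j ≈ cofactorTerm N₁ j +P cofactorTerm N₂ j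
  term j with j Fin.≟ t
  ... | yes refl = ≈-trans (signP-cong (toℕ j) (begin
          M zero j *P det (minor M j)
            ≈⟨ *P-cong (column-t zero) (det-cong λ r c → M≈N₁ (suc r) (punchIn j c) (punchInᵢ≢i j c)) ⟩
          (N₁ zero j +P N₂ zero j) *P det (minor N₁ j)
            ≈⟨ *P-distribʳ (N₁ zero j) (N₂ zero j) _ ⟩
          (N₁ zero j *P det (minor N₁ j)) +P (N₂ zero j *P det (minor N₁ j))
            ≈⟨ +P-congˡ {N₁ zero j *P det (minor N₁ j)} (*P-congʳ (N₂ zero j) (det-cong λ r c →
                 ≈-trans (≈-sym (M≈N₁ (suc r) (punchIn j c) (punchInᵢ≢i j c))) (M≈N₂ (suc r) (punchIn j c) (punchInᵢ≢i j c)))) ⟩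
          (N₁ zero j *P det (minor N₁ j)) +P (N₂ zero j *P det (minor N₂ j))  ∎))
          (signP-+P (toℕ j) _ _)
  ... | no j≢t = ≈-trans (signP-cong (toℕ j) (begin
          M zero j *P det (minor M j)
            ≈⟨ *P-congʳ (M zero j) minors ⟩
          M zero j *P (det (minor N₁ j) +P det (minor N₂ j))
            ≈⟨ distribˡ (M zero j) _ _ ⟩
          (M zero j *P det (minor N₁ j)) +P (M zero j *P det (minor N₂ j))
            ≈⟨ +P-cong (*P-congˡ _ (M≈N₁ zero j j≢t)) (*P-congˡ _ (M≈N₂ zero j j≢t)) ⟩
          (N₁ zero j *P det (minor N₁ j)) +P (N₂ zero j *P det (minor N₂ j))  ∎))
          (signP-+P (toℕ j) _ _)
    where
    t′ = punchOut j≢t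
    avoids-t : ∀ c → c ≢ t′ → punchIn j c ≢ t
    avoids-t c c≢t′ eq = c≢t′ (punchIn-injective j c t′ (≡.trans eq (≡.sym (punchIn-punchOut j≢t))))
    minors : det (minor M j) ≈ det (minor N₁ j) +P det (minor N₂ j)
    minors = det-linear-column (minor M j) (minor N₁ j) (minor N₂ j) t′
      (λ r c c≢t′ → M≈N₁ (suc r) (punchIn j c) (avoids-t c c≢t′))
      (λ r c c≢t′ → M≈N₂ (suc r) (punchIn j c) (avoids-t c c≢t′))
      (λ r → subst (λ c → M (suc r) c ≈ N₁ (suc r) c +P N₂ (suc r) c)
                   (≡.sym (punchIn-punchOut j≢t)) (column-t (suc r)))

punchIn-adjacent : ∀ {k} {a b : Fin (suc k)} → toℕ b ≡ suc (toℕ a) → ∀ c →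
                   punchIn a c ≡ punchIn b c ⊎ (punchIn a c ≡ b × punchIn b c ≡ a)
punchIn-adjacent {a = zero}  {suc zero} refl zero    = inj₂ (refl , refl)
punchIn-adjacent {a = zero}  {suc zero} refl (suc c) = inj₁ refl
punchIn-adjacent {a = suc a} {suc b}    b≡1+a zero    = inj₁ refl
punchIn-adjacent {a = suc a} {suc b}    b≡1+a (suc c) with punchIn-adjacent (ℕ.suc-injective b≡1+a) c
... | inj₁ same           = inj₁ (cong suc same)
... | inj₂ (≡b , ≡a)      = inj₂ (cong suc ≡b , cong suc ≡a)

punchOut-adjacent : ∀ {k} {j a b : Fin (suc k)} (j≢a : j ≢ a) (j≢b : j ≢ b) →
                    toℕ b ≡ suc (toℕ a) → toℕ (punchOut j≢b) ≡ suc (toℕ (punchOut j≢a))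
punchOut-adjacent {j = zero}  {zero}      j≢a j≢b b≡1+a = ⊥-elim (j≢a refl)
punchOut-adjacent {j = zero}  {suc a} {suc b} j≢a j≢b b≡1+a = ℕ.suc-injective b≡1+a
punchOut-adjacent {suc k} {j = suc zero}  {zero} {suc zero} j≢a j≢b refl = ⊥-elim (j≢b refl)
punchOut-adjacent {suc (suc k)} {j = suc (suc j)} {zero} {suc zero} j≢a j≢b refl = refl
punchOut-adjacent {suc k} {j = suc j} {suc a} {suc b} j≢a j≢b b≡1+a =
  cong suc (punchOut-adjacent (j≢a ∘ cong suc) (j≢b ∘ cong suc) (ℕ.suc-injective b≡1+a))

det-adjacent-equal-columns : ∀ {k} (M : Matrix k) (a b : Fin k) → toℕ b ≡ suc (toℕ a) →
                             (∀ r → M r a ≈ M r b) → det M ≈ 0P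
det-adjacent-equal-columns {suc k} M a b b≡1+a a≈b = sum-adjacent-pair (cofactorTerm M) a b b≡1+a others cancel
  where
  others : ∀ j → j ≢ a → j ≢ b → cofactorTerm M j ≈ 0P
  others j j≢a j≢b = signP-zero (toℕ j) (≈-trans (*P-congʳ (M zero j) minor≈0) (*P-zeroʳ (M zero j)))
    where
    minor≈0 : det (minor M j) ≈ 0P
    minor≈0 = det-adjacent-equal-columns (minor M j) (punchOut j≢a) (punchOut j≢b)
      (punchOut-adjacent j≢a j≢b b≡1+a)
      λ r → subst₂ (λ x y → M (suc r) x ≈ M (suc r) y)
                   (≡.sym (punchIn-punchOut j≢a)) (≡.sym (punchIn-punchOut j≢b)) (a≈b (suc r))
  minors-agree : ∀ r c → minor M a r c ≈ minor M b r c
  minors-agree r c with punchIn-adjacent b≡1+a c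
  ... | inj₁ same       = ≈-reflexive (cong (M (suc r)) same)
  ... | inj₂ (≡b , ≡a)  = subst₂ (λ x y → M (suc r) x ≈ M (suc r) y) (≡.sym ≡b) (≡.sym ≡a) (≈-sym (a≈b (suc r)))
  -- the two cofactor terms differ only in their sign
  cancel : cofactorTerm M a +P cofactorTerm M b ≈ 0P
  cancel = ≈-trans (+P-congˡ {cofactorTerm M a}
             (≈-trans (≈-reflexive (cong (λ s → signP s (M zero b *P det (minor M b))) b≡1+a))
                      (negP-cong (signP-cong (toℕ a) (≈-sym (*P-cong (a≈b zero) (det-cong minors-agree)))))))
           (+P-inverseʳ (cofactorTerm M a))

replaceColumn : ∀ {k} → Matrix k → Fin k → (Fin k → Poly) → Matrix k
replaceColumn M b v r c with c Fin.≟ b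
... | yes _ = v r
... | no  _ = M r c

replaceColumn-at : ∀ {k} (M : Matrix k) b v r → replaceColumn M b v r b ≡ v r
replaceColumn-at M b v r with b Fin.≟ b
... | yes _   = refl
... | no b≢b  = ⊥-elim (b≢b refl)

replaceColumn-off : ∀ {k} (M : Matrix k) b v r c → c ≢ b → replaceColumn M b v r c ≡ M r c
replaceColumn-off M b v r c c≢b with c Fin.≟ b
... | yes c≡b = ⊥-elim (c≢b c≡b)
... | no  _   = refl

Adjacent : ∀ {k} → Fin k → Fin k → Set
Adjacent a b = toℕ b ≡ suc (toℕ a) ⊎ toℕ a ≡ suc (toℕ b)

det-subtract-adjacent-column : ∀ {k} (M M′ : Matrix k) (a b : Fin k) → Adjacent a b →
  (∀ r c → c ≢ b → M′ r c ≈ M r c) → (∀ r → M′ r b ≈ M r b +P negP (M r a)) → det M′ ≈ det M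
det-subtract-adjacent-column M M′ a b a~b M′≈M column-b = begin
  det M′            ≈⟨ det-linear-column M′ M Minus b M′≈M (λ r c c≢b → ≈-trans (M′≈M r c c≢b) (off r c c≢b))
                         (λ r → ≈-trans (column-b r) (+P-congˡ {M r b} (≈-sym (at r)))) ⟩
  det M +P det Minus ≈⟨ +P-congˡ {det M} det-Minus≈0 ⟩
  det M +P 0P        ≈⟨ +P-identityʳ (det M) ⟩
  det M              ∎
  where
  Minus Copy Zero : Matrix _
  Minus = replaceColumn M b (λ r → negP (M r a))
  Copy  = replaceColumn M b (λ r → M r a)
  Zero  = replaceColumn M b (λ _ → 0P)
  at : ∀ {v} r → replaceColumn M b v r b ≈ v r
  at {v} r = ≈-reflexive (replaceColumn-at M b v r)
  off : ∀ {v} r c → c ≢ b → M r c ≈ replaceColumn M b v r c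
  off {v} r c c≢b = ≈-reflexive (≡.sym (replaceColumn-off M b v r c c≢b))
  a≢b : a ≢ b
  a≢b refl = [ (λ e → ℕ.1+n≢n (≡.sym e)) , (λ e → ℕ.1+n≢n (≡.sym e)) ]′ a~b
  det-Copy≈0 : det Copy ≈ 0P
  det-Copy≈0 = [ (λ b≡1+a → det-adjacent-equal-columns Copy a b b≡1+a same)
               , (λ a≡1+b → det-adjacent-equal-columns Copy b a a≡1+b (≈-sym ∘ same)) ]′ a~b
    where
    same : ∀ r → Copy r a ≈ Copy r b
    same r = ≈-trans (≈-sym (off r a a≢b)) (≈-sym (at r))
  det-Minus≈0 : det Minus ≈ 0P
  det-Minus≈0 = begin
    det Minus               ≈⟨ +P-identityʳ (det Minus) ⟨
    det Minus +P 0P         ≈⟨ +P-congˡ {det Minus} det-Copy≈0 ⟨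
    det Minus +P det Copy   ≈⟨ det-linear-column Zero Minus Copy b
                                 (λ r c c≢b → ≈-trans (≈-sym (off r c c≢b)) (off r c c≢b))
                                 (λ r c c≢b → ≈-trans (≈-sym (off r c c≢b)) (off r c c≢b))
                                 (λ r → ≈-trans (at r) (≈-trans (≈-sym (+P-inverseˡ (M r a)))
                                          (≈-sym (+P-cong (at r) (at r))))) ⟨
    det Zero                ≈⟨ det-zero-column Zero b at ⟩
    0P                      ∎

if-yes : ∀ {P X : Set} (d : Dec P) {x y : X} → P → (if does d then x else y) ≡ x
if-yes d p = cong (if_then _ else _) (dec-true d p)

if-no : ∀ {P X : Set} (d : Dec P) {x y : X} → ¬ P → (if does d then x else y) ≡ y
if-no d ¬p = cong (if_then _ else _) (dec-false d ¬p)

entries : ∀ {k} → (ℕ → ℕ → Poly) → Matrix k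
entries e r c = e (toℕ r) (toℕ c)

forwardDiff : ℕ → (ℕ → ℕ → Poly) → ℕ → ℕ → Poly
forwardDiff p e i j = if does (j <? p) then e i j +P negP (e i (suc j)) else e i j

backwardDiff : ℕ → (ℕ → ℕ → Poly) → ℕ → ℕ → Poly
backwardDiff p e i j = if does (p <? j) then e i j +P negP (e i (pred j)) else e i j

forwardDiff-< : ∀ {p} e {i j} → j < p → forwardDiff p e i j ≡ e i j +P negP (e i (suc j))
forwardDiff-< {p} e {j = j} j<p = if-yes (j <? p) j<p

forwardDiff-≥ : ∀ {p} e {i j} → p ≤ j → forwardDiff p e i j ≡ e i j
forwardDiff-≥ {p} e {j = j} p≤j = if-no (j <? p) (ℕ.≤⇒≯ p≤j)

backwardDiff-> : ∀ {p} e {i j} → p < j → backwardDiff p e i j ≡ e i j +P negP (e i (pred j))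
backwardDiff-> {p} e {j = j} p<j = if-yes (p <? j) p<j

backwardDiff-≤ : ∀ {p} e {i j} → j ≤ p → backwardDiff p e i j ≡ e i j
backwardDiff-≤ {p} e {j = j} j≤p = if-no (p <? j) (ℕ.≤⇒≯ j≤p)

det-forwardDiff : ∀ {k} p e → p < k → det (entries {k} (forwardDiff p e)) ≈ det (entries {k} e)
det-forwardDiff {k} zero e 0<k = det-cong {k} λ r c → ≈-reflexive (forwardDiff-≥ e z≤n)
det-forwardDiff {k} (suc p) e 1+p<k = ≈-trans step (det-forwardDiff p e p<k)
  where
  p<k = ℕ.<-trans (ℕ.n<1+n p) 1+p<k
  b a : Fin k
  b = fromℕ< p<k
  a = fromℕ< 1+p<k
  a~b : Adjacent a b
  a~b = inj₂ (≡.trans (toℕ-fromℕ< 1+p<k) (cong suc (≡.sym (toℕ-fromℕ< p<k))))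
  step : det (entries {k} (forwardDiff (suc p) e)) ≈ det (entries {k} (forwardDiff p e))
  step = det-subtract-adjacent-column _ _ a b a~b off on
    where
    off : ∀ r c → c ≢ b → forwardDiff (suc p) e (toℕ r) (toℕ c) ≈ forwardDiff p e (toℕ r) (toℕ c)
    off r c c≢b with ℕ.<-cmp (toℕ c) p
    ... | tri< c<p _ _ = ≈-reflexive (≡.trans (forwardDiff-< e (ℕ.m<n⇒m<1+n c<p)) (≡.sym (forwardDiff-< e c<p)))
    ... | tri≈ _ c≡p _ = ⊥-elim (c≢b (toℕ-injective (≡.trans c≡p (≡.sym (toℕ-fromℕ< p<k)))))
    ... | tri> _ _ p<c = ≈-reflexive (≡.trans (forwardDiff-≥ e p<c) (≡.sym (forwardDiff-≥ e (ℕ.<⇒≤ p<c))))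
    on : ∀ r → forwardDiff (suc p) e (toℕ r) (toℕ b)
             ≈ forwardDiff p e (toℕ r) (toℕ b) +P negP (forwardDiff p e (toℕ r) (toℕ a))
    on r rewrite toℕ-fromℕ< p<k | toℕ-fromℕ< 1+p<k =
      ≈-reflexive (≡.trans (forwardDiff-< e (ℕ.n<1+n p))
                   (≡.sym (cong₂ (λ x y → x +P negP y) (forwardDiff-≥ e ℕ.≤-refl) (forwardDiff-≥ e (ℕ.n≤1+n p)))))

det-backwardDiff : ∀ {k} p e → det (entries {k} (backwardDiff p e)) ≈ det (entries {k} e)
det-backwardDiff {k} p e = go k p (ℕ.m≤m+n k p)
  where
  unchanged : ∀ {p} → (∀ (c : Fin k) → toℕ c ≤ p) → det (entries {k} (backwardDiff p e)) ≈ det (entries {k} e)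
  unchanged c≤p = det-cong {k} λ r c → ≈-reflexive (backwardDiff-≤ e (c≤p c))
  go : ∀ d p → k ≤ d ℕ.+ p → det (entries {k} (backwardDiff p e)) ≈ det (entries {k} e)
  go zero    p k≤p = unchanged λ c → ℕ.<⇒≤ (ℕ.<-≤-trans (toℕ<n c) k≤p)
  go (suc d) p k≤1+d+p with suc p <? k
  ... | no  1+p≮k = unchanged λ c → ℕ.≤-pred (ℕ.≤-trans (toℕ<n c) (ℕ.≮⇒≥ 1+p≮k))
  ... | yes 1+p<k = ≈-trans step (go d (suc p) (subst (k ≤_) (≡.sym (ℕ.+-suc d p)) k≤1+d+p))
    where
    p<k = ℕ.<-trans (ℕ.n<1+n p) 1+p<k
    a b : Fin k
    a = fromℕ< p<k
    b = fromℕ< 1+p<k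
    a~b : Adjacent a b
    a~b = inj₁ (≡.trans (toℕ-fromℕ< 1+p<k) (cong suc (≡.sym (toℕ-fromℕ< p<k))))
    step : det (entries {k} (backwardDiff p e)) ≈ det (entries {k} (backwardDiff (suc p) e))
    step = det-subtract-adjacent-column _ _ a b a~b off on
      where
      off : ∀ r c → c ≢ b → backwardDiff p e (toℕ r) (toℕ c) ≈ backwardDiff (suc p) e (toℕ r) (toℕ c)
      off r c c≢b with ℕ.<-cmp (toℕ c) (suc p)
      ... | tri< c<1+p _ _ = ≈-reflexive (≡.trans (backwardDiff-≤ e (ℕ.≤-pred c<1+p))
                                                  (≡.sym (backwardDiff-≤ e (ℕ.<⇒≤ c<1+p))))
      ... | tri≈ _ c≡1+p _ = ⊥-elim (c≢b (toℕ-injective (≡.trans c≡1+p (≡.sym (toℕ-fromℕ< 1+p<k)))))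
      ... | tri> _ _ 1+p<c = ≈-reflexive (≡.trans (backwardDiff-> e (ℕ.<-trans (ℕ.n<1+n p) 1+p<c))
                                                  (≡.sym (backwardDiff-> e 1+p<c)))
      on : ∀ r → backwardDiff p e (toℕ r) (toℕ b)
               ≈ backwardDiff (suc p) e (toℕ r) (toℕ b) +P negP (backwardDiff (suc p) e (toℕ r) (toℕ a))
      on r rewrite toℕ-fromℕ< p<k | toℕ-fromℕ< 1+p<k =
        ≈-reflexive (≡.trans (backwardDiff-> e (ℕ.n<1+n p))
                     (≡.sym (cong₂ (λ x y → x +P negP y) (backwardDiff-≤ e ℕ.≤-refl) (backwardDiff-≤ e (ℕ.n≤1+n p)))))

toℕ-punchIn-< : ∀ {k} (i : Fin (suc k)) (c : Fin k) → toℕ c < toℕ i → toℕ (punchIn i c) ≡ toℕ c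
toℕ-punchIn-< (suc i) zero    _         = refl
toℕ-punchIn-< (suc i) (suc c) (s≤s c<i) = cong suc (toℕ-punchIn-< i c c<i)

toℕ-punchIn-≥ : ∀ {k} (i : Fin (suc k)) (c : Fin k) → toℕ i ≤ toℕ c → toℕ (punchIn i c) ≡ suc (toℕ c)
toℕ-punchIn-≥ zero    c       _         = refl
toℕ-punchIn-≥ (suc i) (suc c) (s≤s i≤c) = cong suc (toℕ-punchIn-≥ i c i≤c)

toℕ-punchIn-≤ : ∀ {k} (i : Fin (suc k)) (c : Fin k) → toℕ (punchIn i c) ≤ suc (toℕ c)
toℕ-punchIn-≤ zero    c       = ℕ.≤-refl
toℕ-punchIn-≤ (suc i) zero    = z≤n
toℕ-punchIn-≤ (suc i) (suc c) = s≤s (toℕ-punchIn-≤ i c)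

punchIn-↑ˡ : ∀ {k} l (j : Fin (suc k)) (c : Fin k) → punchIn (j ↑ˡ l) (c ↑ˡ l) ≡ punchIn j c ↑ˡ l
punchIn-↑ˡ l zero    c       = refl
punchIn-↑ˡ l (suc j) zero    = refl
punchIn-↑ˡ l (suc j) (suc c) = cong suc (punchIn-↑ˡ l j c)

punchIn-↑ʳ : ∀ k {l} (j : Fin (suc k)) (c : Fin l) → punchIn (j ↑ˡ l) (k ↑ʳ c) ≡ suc (k ↑ʳ c)
punchIn-↑ʳ k       zero    c = refl
punchIn-↑ʳ (suc k) (suc j) c = cong suc (punchIn-↑ʳ k j c)

det-zero-block : ∀ {k} (M : Matrix k) p q → p < k → p < q →
                 (∀ r c → p ≤ toℕ r → toℕ c < q → M r c ≈ 0P) → det M ≈ 0P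
det-zero-block {suc k} M zero    q       _     0<q block = det-zero-column M zero λ r → block r zero z≤n 0<q
det-zero-block {suc k} M (suc p) (suc q) 1+p<k p<q block = sum-zero (cofactorTerm M) λ j →
  signP-zero (toℕ j) (≈-trans (*P-congʳ (M zero j)
    (det-zero-block (minor M j) p q (ℕ.≤-pred 1+p<k) (ℕ.≤-pred p<q)
       λ r c p≤r c<q → block (suc r) (punchIn j c) (s≤s p≤r) (ℕ.≤-<-trans (toℕ-punchIn-≤ j c) (s≤s c<q))))
    (*P-zeroʳ (M zero j)))

topLeft : ∀ k {l} → Matrix (k ℕ.+ l) → Matrix k
topLeft k {l} M r c = M (r ↑ˡ l) (c ↑ˡ l)

bottomRight : ∀ k {l} → Matrix (k ℕ.+ l) → Matrix l
bottomRight k M r c = M (k ↑ʳ r) (k ↑ʳ c)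

private
  cofactors-topLeft : ∀ k {l} (M : Matrix (suc k ℕ.+ l)) d →
    (∀ j → det (minor M (j ↑ˡ l)) ≈ det (minor (topLeft (suc k) M) j) *P d) →
    sumP (λ j → cofactorTerm M (j ↑ˡ l)) ≈ det (topLeft (suc k) M) *P d
  cofactors-topLeft k {l} M d minors = ≈-trans (sum-cong term) (sum-*P (cofactorTerm (topLeft (suc k) M)) d)
    where
    term : ∀ j → cofactorTerm M (j ↑ˡ l) ≈ cofactorTerm (topLeft (suc k) M) j *P d
    term j = begin
      signP (toℕ (j ↑ˡ l)) (M zero (j ↑ˡ l) *P det (minor M (j ↑ˡ l)))
        ≈⟨ ≈-reflexive (cong (λ s → signP s (M zero (j ↑ˡ l) *P det (minor M (j ↑ˡ l)))) (toℕ-↑ˡ j l)) ⟩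
      signP (toℕ j) (M zero (j ↑ˡ l) *P det (minor M (j ↑ˡ l)))
        ≈⟨ signP-cong (toℕ j) (≈-trans (*P-congʳ (M zero (j ↑ˡ l)) (minors j))
                                       (≈-sym (*P-assoc (M zero (j ↑ˡ l)) (det (minor (topLeft (suc k) M) j)) d))) ⟩
      signP (toℕ j) ((M zero (j ↑ˡ l) *P det (minor (topLeft (suc k) M) j)) *P d)
        ≈⟨ signP-*Pˡ (toℕ j) _ d ⟩
      cofactorTerm (topLeft (suc k) M) j *P d  ∎

  minor-blocks : ∀ k {l} (M : Matrix (suc k ℕ.+ l)) j →
    det (topLeft k (minor M (j ↑ˡ l))) *P det (bottomRight k (minor M (j ↑ˡ l)))
      ≈ det (minor (topLeft (suc k) M) j) *P det (bottomRight (suc k) M)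
  minor-blocks k {l} M j =
    *P-cong (det-cong λ r c → ≈-reflexive (cong (M (suc (r ↑ˡ l))) (punchIn-↑ˡ l j c)))
            (det-cong λ r c → ≈-reflexive (cong (M (suc (k ↑ʳ r))) (punchIn-↑ʳ k j c)))

det-block-upper : ∀ k {l} (M : Matrix (k ℕ.+ l)) → (∀ r c → toℕ r < k → k ≤ toℕ c → M r c ≈ 0P) →
                  det M ≈ det (topLeft k M) *P det (bottomRight k M)
det-block-upper zero    M _     = ≈-sym (*P-identityˡ (det M))
det-block-upper (suc k) {l} M upper = begin
  det M
    ≈⟨ sum-++ (suc k) (cofactorTerm M) ⟩
  sumP (λ j → cofactorTerm M (j ↑ˡ l)) +P sumP (λ j → cofactorTerm M (suc k ↑ʳ j))
    ≈⟨ +P-cong (cofactors-topLeft k M (det (bottomRight (suc k) M)) minors) (sum-zero _ right-terms) ⟩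
  (det (topLeft (suc k) M) *P det (bottomRight (suc k) M)) +P 0P
    ≈⟨ +P-identityʳ _ ⟩
  det (topLeft (suc k) M) *P det (bottomRight (suc k) M)  ∎
  where
  right-terms : ∀ j → cofactorTerm M (suc k ↑ʳ j) ≈ 0P
  right-terms j = signP-zero (toℕ (suc k ↑ʳ j)) (*P-zeroˡ-≈ _ (upper zero (suc k ↑ʳ j) (s≤s z≤n)
    (ℕ.≤-trans (ℕ.m≤m+n (suc k) (toℕ j)) (ℕ.≤-reflexive (≡.sym (toℕ-↑ʳ (suc k) j))))))
  minors : ∀ j → det (minor M (j ↑ˡ l)) ≈ det (minor (topLeft (suc k) M) j) *P det (bottomRight (suc k) M)
  minors j = ≈-trans (det-block-upper k (minor M (j ↑ˡ l)) λ r c r<k k≤c →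
                        upper (suc r) (punchIn (j ↑ˡ l) c) (s≤s r<k)
                          (subst (suc k ≤_) (≡.sym (toℕ-punchIn-≥ (j ↑ˡ l) c (j≤c c k≤c))) (s≤s k≤c)))
                     (minor-blocks k M j)
    where
    j≤c : ∀ c → k ≤ toℕ c → toℕ (j ↑ˡ l) ≤ toℕ c
    j≤c c k≤c = ℕ.≤-trans (ℕ.≤-reflexive (toℕ-↑ˡ j l)) (ℕ.≤-trans (ℕ.≤-pred (toℕ<n j)) k≤c)

det-block-lower : ∀ k {l} (M : Matrix (k ℕ.+ l)) → (∀ r c → k ≤ toℕ r → toℕ c < k → M r c ≈ 0P) →
                  det M ≈ det (topLeft k M) *P det (bottomRight k M)
det-block-lower zero    M _     = ≈-sym (*P-identityˡ (det M))
det-block-lower (suc k) {l} M lower = begin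
  det M
    ≈⟨ sum-++ (suc k) (cofactorTerm M) ⟩
  sumP (λ j → cofactorTerm M (j ↑ˡ l)) +P sumP (λ j → cofactorTerm M (suc k ↑ʳ j))
    ≈⟨ +P-cong (cofactors-topLeft k M (det (bottomRight (suc k) M)) minors) (sum-zero _ right-terms) ⟩
  (det (topLeft (suc k) M) *P det (bottomRight (suc k) M)) +P 0P
    ≈⟨ +P-identityʳ _ ⟩
  det (topLeft (suc k) M) *P det (bottomRight (suc k) M)  ∎
  where
  minors : ∀ j → det (minor M (j ↑ˡ l)) ≈ det (minor (topLeft (suc k) M) j) *P det (bottomRight (suc k) M)
  minors j = ≈-trans (det-block-lower k (minor M (j ↑ˡ l)) λ r c k≤r c<k →
                        lower (suc r) (punchIn (j ↑ˡ l) c) (s≤s k≤r) (ℕ.≤-<-trans (toℕ-punchIn-≤ (j ↑ˡ l) c) (s≤s c<k)))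
                     (minor-blocks k M j)
  -- Deleting a column of the right block leaves the l × (k + 1) zero block intact.
  right-terms : ∀ j → cofactorTerm M (suc k ↑ʳ j) ≈ 0P
  right-terms j = signP-zero (toℕ (suc k ↑ʳ j)) (≈-trans (*P-congʳ (M zero (suc k ↑ʳ j))
    (det-zero-block (minor M (suc k ↑ʳ j)) k (suc k) k<k+l (ℕ.n<1+n k) λ r c k≤r c≤k →
       lower (suc r) (punchIn (suc k ↑ʳ j) c) (s≤s k≤r)
         (subst (_< suc k) (≡.sym (toℕ-punchIn-< (suc k ↑ʳ j) c (ℕ.<-≤-trans c≤k k≤j))) c≤k)))
    (*P-zeroʳ (M zero (suc k ↑ʳ j))))
    where
    k≤j : suc k ≤ toℕ (suc k ↑ʳ j)
    k≤j = ℕ.≤-trans (ℕ.m≤m+n (suc k) (toℕ j)) (ℕ.≤-reflexive (≡.sym (toℕ-↑ʳ (suc k) j)))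
    k<k+l : k < k ℕ.+ l
    k<k+l = ℕ.≤-trans (ℕ.≤-reflexive (ℕ.+-comm 1 k)) (ℕ.+-monoʳ-≤ k (ℕ.≤-trans (s≤s z≤n) (toℕ<n j)))

det-upper-triangular : ∀ {k} γ (M : Matrix k) → (∀ r → M r r ≈ γ) →
                       (∀ r c → toℕ c < toℕ r → M r c ≈ 0P) → det M ≈ γ ^ k
det-upper-triangular {zero}  γ M _        _     = ≈-refl
det-upper-triangular {suc k} γ M diagonal lower =
  ≈-trans (sum-head (cofactorTerm M) later-terms)
          (*P-cong (diagonal zero) (det-upper-triangular γ (minor M zero) (diagonal ∘ suc)
                                      λ r c c<r → lower (suc r) (suc c) (s≤s c<r)))
  where
  later-terms : ∀ j → cofactorTerm M (suc j) ≈ 0P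
  later-terms j = signP-zero (suc (toℕ j)) (≈-trans (*P-congʳ (M zero (suc j))
    (minor-zero-column M (suc j) zero (λ ()) λ r → lower (suc r) zero (s≤s z≤n))) (*P-zeroʳ (M zero (suc j))))

record BidiagonalWithOnesColumn {k} (γ : Poly) (M : Matrix (suc k)) : Set where
  field
    first-column  : ∀ r → M r zero ≈ 1P
    diagonal      : ∀ r → r ≢ zero → M r r ≈ γ
    superdiagonal : ∀ r c → toℕ c ≡ suc (toℕ r) → M r c ≈ negP γ
    elsewhere     : ∀ r c → c ≢ zero → r ≢ c → toℕ c ≢ suc (toℕ r) → M r c ≈ 0P
open BidiagonalWithOnesColumn

det-bidiagonalWithOnesColumn : ∀ k γ (M : Matrix (suc k)) → BidiagonalWithOnesColumn γ M →
                               det M ≈ suc k · γ ^ k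
det-bidiagonalWithOnesColumn zero γ M B =
  ≈-trans (+P-identityʳ _) (≈-trans (*P-congˡ 1P (first-column B zero)) (*P-identityˡ 1P))
det-bidiagonalWithOnesColumn (suc k) γ M B = begin
  det M
    ≈⟨ +P-congˡ {cofactorTerm M zero} (sum-head (λ j → cofactorTerm M (suc j)) later-terms) ⟩
  cofactorTerm M zero +P cofactorTerm M (suc zero)
    ≈⟨ +P-cong (≈-trans (*P-congˡ _ (first-column B zero)) (*P-identityˡ _)) second-term ⟩
  det (minor M zero) +P (γ *P (suc k · γ ^ k))
    ≈⟨ +P-cong (det-upper-triangular γ (minor M zero) (λ r → diagonal B (suc r) λ ())
                 λ r c c<r → elsewhere B (suc r) (suc c) (λ ()) (c≢r c<r ∘ ≡.sym ∘ suc-injective)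
                                (λ c≡1+r → ℕ.<-asym c<r (ℕ.≤-trans (ℕ.n<1+n _)
                                                                   (ℕ.≤-reflexive (≡.sym (ℕ.suc-injective c≡1+r))))))
               (×-comm-* (suc k) γ (γ ^ k)) ⟩
  (γ ^ suc k) +P (suc k · γ ^ suc k)  ∎
  where
  c≢r : ∀ {c r : Fin (suc k)} → toℕ c < toℕ r → c ≢ r
  c≢r c<r refl = ℕ.<-irrefl refl c<r
  later-terms : ∀ j → cofactorTerm M (suc (suc j)) ≈ 0P
  later-terms j = signP-zero (toℕ (suc (suc j))) (*P-zeroˡ-≈ _ (elsewhere B zero (suc (suc j)) (λ ()) (λ ())
                    (ℕ.1+n≢0 ∘ ℕ.suc-injective)))
  rest : BidiagonalWithOnesColumn γ (minor M (suc zero))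
  rest = record
    { first-column  = λ r → first-column B (suc r)
    ; diagonal      = λ { zero r≢0 → ⊥-elim (r≢0 refl) ; (suc r) _ → diagonal B (suc (suc r)) λ () }
    ; superdiagonal = λ { r zero () ; r (suc c) c≡1+r → superdiagonal B (suc r) (suc (suc c)) (cong suc c≡1+r) }
    ; elsewhere     = λ { r zero c≢0 _ _ → ⊥-elim (c≢0 refl)
                        ; r (suc c) _ r≢c c≢1+r → elsewhere B (suc r) (suc (suc c)) (λ ())
                                                    (r≢c ∘ suc-injective) (c≢1+r ∘ ℕ.suc-injective) } }
  second-term : cofactorTerm M (suc zero) ≈ γ *P (suc k · γ ^ k)
  second-term = begin
    negP (M zero (suc zero) *P det (minor M (suc zero)))
      ≈⟨ negP-cong (*P-cong (superdiagonal B zero (suc zero) refl) (det-bidiagonalWithOnesColumn k γ _ rest)) ⟩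
    negP (negP γ *P (suc k · γ ^ k))
      ≈⟨ negP-cong (≈-sym (-‿distribˡ-* γ _)) ⟩
    negP (negP (γ *P (suc k · γ ^ k)))
      ≈⟨ -‿involutive _ ⟩
    γ *P (suc k · γ ^ k)  ∎

topLeft-entries : ∀ k {l} e (r c : Fin k) → topLeft k (entries {k ℕ.+ l} e) r c ≡ e (toℕ r) (toℕ c)
topLeft-entries k {l} e r c = cong₂ e (toℕ-↑ˡ r l) (toℕ-↑ˡ c l)

bottomRight-entries : ∀ k {l} e (r c : Fin l) → bottomRight k (entries {k ℕ.+ l} e) r c ≡ e (k ℕ.+ toℕ r) (k ℕ.+ toℕ c)
bottomRight-entries k e r c = cong₂ e (toℕ-↑ʳ k r) (toℕ-↑ʳ k c)

-- Join block matrices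

appendOnes : ℕ → (ℕ → ℕ → Poly) → ℕ → ℕ → Poly
appendOnes n A i j = if does (j <? n) then A i j else 1P

setColumn : ℕ → (ℕ → Poly) → (ℕ → ℕ → Poly) → ℕ → ℕ → Poly
setColumn n v e i j = if does (j ℕ.≟ n) then v i else e i j

-- [[A, J], [J, γI + J]] with A of size n and J the all-ones matrices.
joinEntries : ℕ → (ℕ → ℕ → Poly) → Poly → ℕ → ℕ → Poly
joinEntries n A γ i j =
  if does (i <? n) then appendOnes n A i j
  else if does (j <? n) then 1P
  else if does (i ℕ.≟ j) then γ +P 1P
  else 1P

module JoinEntries (n : ℕ) (A : ℕ → ℕ → Poly) (γ : Poly) where

  joinEntries-top : ∀ {i j} → i < n → joinEntries n A γ i j ≡ appendOnes n A i j
  joinEntries-top {i} i<n = if-yes (i <? n) i<n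

  joinEntries-bottomLeft : ∀ {i j} → n ≤ i → j < n → joinEntries n A γ i j ≡ 1P
  joinEntries-bottomLeft {i} {j} n≤i j<n = ≡.trans (if-no (i <? n) (ℕ.≤⇒≯ n≤i)) (if-yes (j <? n) j<n)

  joinEntries-bottomRight : ∀ {i j} → n ≤ i → n ≤ j → joinEntries n A γ i j ≡ (if does (i ℕ.≟ j) then γ +P 1P else 1P)
  joinEntries-bottomRight {i} {j} n≤i n≤j = ≡.trans (if-no (i <? n) (ℕ.≤⇒≯ n≤i)) (if-no (j <? n) (ℕ.≤⇒≯ n≤j))

  joinEntries-diagonal : ∀ x → joinEntries n A γ (n ℕ.+ x) (n ℕ.+ x) ≡ γ +P 1P
  joinEntries-diagonal x = ≡.trans (joinEntries-bottomRight (ℕ.m≤m+n n x) (ℕ.m≤m+n n x)) (if-yes (n ℕ.+ x ℕ.≟ n ℕ.+ x) refl)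

  joinEntries-offDiagonal : ∀ {x y} → x ≢ y → joinEntries n A γ (n ℕ.+ x) (n ℕ.+ y) ≡ 1P
  joinEntries-offDiagonal {x} {y} x≢y = ≡.trans (joinEntries-bottomRight (ℕ.m≤m+n n x) (ℕ.m≤m+n n y))
                                                (if-no (n ℕ.+ x ℕ.≟ n ℕ.+ y) (x≢y ∘ ℕ.+-cancelˡ-≡ n _ _))

-- E subtracts from each column of the complete block its left neighbour. Column n of E is γ·eₙ + 𝟙;
-- with γ·eₙ (Eb) it is block upper triangular, and with 𝟙 (Ea) forward differences of the first
-- n columns make it block lower triangular.
module JoinDeterminant (n : ℕ) (A : ℕ → ℕ → Poly) (γ : Poly) (m : ℕ) where

  open JoinEntries n A γ

  γ-at-n : ℕ → Poly
  γ-at-n i = if does (i ℕ.≟ n) then γ else 0P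

  J E Eb Ea Ea′ : ℕ → ℕ → Poly
  J   = joinEntries n A γ
  E   = backwardDiff n J
  Eb  = setColumn n γ-at-n E
  Ea  = setColumn n (λ _ → 1P) E
  Ea′ = forwardDiff n Ea

  private
    n<n+1+ : ∀ x → n < n ℕ.+ suc x
    n<n+1+ x = ℕ.m<m+n n (s≤s z≤n)

    n+1+≢n : ∀ x → n ℕ.+ suc x ≢ n
    n+1+≢n x e = ℕ.1+n≢0 (ℕ.+-cancelˡ-≡ n _ _ (≡.trans e (≡.sym (ℕ.+-identityʳ n))))

    [γ+1]-1≈γ : (γ +P 1P) +P negP 1P ≈ γ
    [γ+1]-1≈γ = ≈-trans (+P-assoc γ 1P (negP 1P)) (≈-trans (+P-congˡ {γ} (+P-inverseʳ 1P)) (+P-identityʳ γ))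

    1-[γ+1]≈-γ : 1P +P negP (γ +P 1P) ≈ negP γ
    1-[γ+1]≈-γ = ≈-trans (+P-congˡ {1P} (≈-sym (-‿+-comm γ 1P)))
              (≈-trans (+P-swap 1P (negP γ) (negP 1P)) (≈-trans (+P-congˡ {negP γ} (+P-inverseʳ 1P)) (+P-identityʳ (negP γ))))

  E-complete : ∀ x y → E (n ℕ.+ x) (n ℕ.+ suc y) ≡ J (n ℕ.+ x) (n ℕ.+ suc y) +P negP (J (n ℕ.+ x) (n ℕ.+ y))
  E-complete x y = ≡.trans (backwardDiff-> J (n<n+1+ y))
    (cong (λ j → J (n ℕ.+ x) (n ℕ.+ suc y) +P negP (J (n ℕ.+ x) j)) (cong pred (ℕ.+-suc n y)))

  E-diagonal : ∀ x → E (n ℕ.+ suc x) (n ℕ.+ suc x) ≈ γ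
  E-diagonal x = ≈-trans (≈-reflexive (≡.trans (E-complete (suc x) x)
                   (cong₂ (λ u v → u +P negP v) (joinEntries-diagonal (suc x)) (joinEntries-offDiagonal ℕ.1+n≢n))))
                     [γ+1]-1≈γ

  E-superdiagonal : ∀ x → E (n ℕ.+ x) (n ℕ.+ suc x) ≈ negP γ
  E-superdiagonal x = ≈-trans (≈-reflexive (≡.trans (E-complete x x)
                        (cong₂ (λ u v → u +P negP v) (joinEntries-offDiagonal (ℕ.1+n≢n ∘ ≡.sym)) (joinEntries-diagonal x))))
                          1-[γ+1]≈-γ

  E-elsewhere : ∀ {x y} → x ≢ suc y → x ≢ y → E (n ℕ.+ x) (n ℕ.+ suc y) ≈ 0P
  E-elsewhere {x} {y} x≢1+y x≢y = ≈-trans (≈-reflexive (≡.trans (E-complete x y)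
                                    (cong₂ (λ u v → u +P negP v) (joinEntries-offDiagonal x≢1+y) (joinEntries-offDiagonal x≢y))))
                                      (+P-inverseʳ 1P)

  E-left : ∀ {i j} → j ≤ n → E i j ≡ J i j
  E-left = backwardDiff-≤ J

  appendOnes-≥ : ∀ {i j} → n ≤ j → appendOnes n A i j ≡ 1P
  appendOnes-≥ {j = j} n≤j = if-no (j <? n) (ℕ.≤⇒≯ n≤j)

  E-topRight : ∀ {i j} → i < n → n < j → E i j ≈ 0P
  E-topRight {i} {suc j} i<n n<1+j = ≈-trans (≈-reflexive (≡.trans (backwardDiff-> J n<1+j)
    (cong₂ (λ u v → u +P negP v) (≡.trans (joinEntries-top i<n) (appendOnes-≥ (ℕ.<⇒≤ n<1+j)))
                                 (≡.trans (joinEntries-top i<n) (appendOnes-≥ (ℕ.≤-pred n<1+j))))))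
    (+P-inverseʳ 1P)

  setColumn-at : ∀ v e {i j} → j ≡ n → setColumn n v e i j ≡ v i
  setColumn-at v e {j = j} j≡n = if-yes (j ℕ.≟ n) j≡n

  setColumn-off : ∀ v e {i j} → j ≢ n → setColumn n v e i j ≡ e i j
  setColumn-off v e {j = j} j≢n = if-no (j ℕ.≟ n) j≢n

  column-n : ∀ i → E i n ≈ Eb i n +P Ea i n
  column-n i = ≈-reflexive (≡.trans (E-left ℕ.≤-refl) (≡.trans (J-column i)
                 (≡.sym (cong₂ _+P_ (setColumn-at γ-at-n E refl) (setColumn-at (λ _ → 1P) E refl)))))
    where
    J-column : ∀ i → J i n ≡ γ-at-n i +P 1P
    J-column i with ℕ.<-cmp i n
    ... | tri< i<n i≢n _ = ≡.trans (joinEntries-top i<n) (≡.trans (appendOnes-≥ ℕ.≤-refl)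
                                                        (≡.sym (cong (_+P 1P) (if-no (i ℕ.≟ n) i≢n))))
    ... | tri≈ _ i≡n _   = ≡.trans (joinEntries-bottomRight (ℕ.≤-reflexive (≡.sym i≡n)) ℕ.≤-refl)
                                   (≡.trans (if-yes (i ℕ.≟ n) i≡n) (≡.sym (cong (_+P 1P) (if-yes (i ℕ.≟ n) i≡n))))
    ... | tri> _ i≢n n<i = ≡.trans (joinEntries-bottomRight (ℕ.<⇒≤ n<i) ℕ.≤-refl)
                                   (≡.trans (if-no (i ℕ.≟ n) i≢n) (≡.sym (cong (_+P 1P) (if-no (i ℕ.≟ n) i≢n))))

  private
    S = n ℕ.+ suc m
    n<S = n<n+1+ m

    det-A : det (topLeft n (entries {S} Eb)) ≈ det (entries {n} A)
    det-A = det-cong λ r c → ≈-reflexive (≡.trans (topLeft-entries n Eb r c)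
      (≡.trans (setColumn-off γ-at-n E (ℕ.<⇒≢ (toℕ<n c))) (≡.trans (E-left (ℕ.<⇒≤ (toℕ<n c)))
      (≡.trans (joinEntries-top (toℕ<n r)) (if-yes (toℕ c <? n) (toℕ<n c))))))

    Eb-topRight : ∀ {i j} → i < n → n ≤ j → Eb i j ≈ 0P
    Eb-topRight {i} {j} i<n n≤j with j ℕ.≟ n
    ... | yes j≡n = ≈-reflexive (≡.trans (setColumn-at γ-at-n E j≡n) (if-no (i ℕ.≟ n) (ℕ.<⇒≢ i<n)))
    ... | no  j≢n = ≈-trans (≈-reflexive (setColumn-off γ-at-n E j≢n)) (E-topRight i<n (ℕ.≤∧≢⇒< n≤j (j≢n ∘ ≡.sym)))

    Eb-diagonal : ∀ x → Eb (n ℕ.+ x) (n ℕ.+ x) ≈ γ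
    Eb-diagonal zero    = ≈-reflexive (≡.trans (setColumn-at γ-at-n E (ℕ.+-identityʳ n)) (if-yes (n ℕ.+ 0 ℕ.≟ n) (ℕ.+-identityʳ n)))
    Eb-diagonal (suc x) = ≈-trans (≈-reflexive (setColumn-off γ-at-n E (n+1+≢n x))) (E-diagonal x)

    Eb-below : ∀ {x y} → y < x → Eb (n ℕ.+ x) (n ℕ.+ y) ≈ 0P
    Eb-below {suc x} {zero}  _ = ≈-reflexive (≡.trans (setColumn-at γ-at-n E (ℕ.+-identityʳ n)) (if-no (n ℕ.+ suc x ℕ.≟ n) (n+1+≢n x)))
    Eb-below {x}     {suc y} y<x = ≈-trans (≈-reflexive (setColumn-off γ-at-n E (n+1+≢n y)))
                                           (E-elsewhere (ℕ.<⇒≢ y<x ∘ ≡.sym) (ℕ.<⇒≢ (ℕ.<-trans (ℕ.n<1+n y) y<x) ∘ ≡.sym))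

    det-Eb : det (entries {S} Eb) ≈ det (entries {n} A) *P (γ ^ suc m)
    det-Eb = ≈-trans (det-block-upper n (entries Eb) λ r c → Eb-topRight)
      (*P-cong det-A (det-upper-triangular γ (bottomRight n (entries {S} Eb))
        (λ r → ≈-trans (≈-reflexive (bottomRight-entries n Eb r r)) (Eb-diagonal (toℕ r)))
        (λ r c c<r → ≈-trans (≈-reflexive (bottomRight-entries n Eb r c)) (Eb-below c<r))))

    Ea-top : ∀ {i j} → i < n → j ≤ n → Ea i j ≡ appendOnes n A i j
    Ea-top {i} {j} i<n j≤n with j ℕ.≟ n
    ... | yes j≡n = ≡.trans (setColumn-at (λ _ → 1P) E j≡n) (≡.sym (appendOnes-≥ (ℕ.≤-reflexive (≡.sym j≡n))))
    ... | no  j≢n = ≡.trans (setColumn-off (λ _ → 1P) E j≢n) (≡.trans (E-left j≤n) (joinEntries-top i<n))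

    Ea-bottomLeft : ∀ {i j} → n ≤ i → j ≤ n → Ea i j ≡ 1P
    Ea-bottomLeft {i} {j} n≤i j≤n with j ℕ.≟ n
    ... | yes j≡n = setColumn-at (λ _ → 1P) E j≡n
    ... | no  j≢n = ≡.trans (setColumn-off (λ _ → 1P) E j≢n) (≡.trans (E-left j≤n) (joinEntries-bottomLeft n≤i (ℕ.≤∧≢⇒< j≤n j≢n)))

    det-A′ : det (topLeft n (entries {S} Ea′)) ≈ det (entries {n} (forwardDiff n (appendOnes n A)))
    det-A′ = det-cong λ r c → ≈-reflexive (≡.trans (topLeft-entries n Ea′ r c)
      (≡.trans (forwardDiff-< Ea (toℕ<n c))
      (≡.trans (cong₂ (λ u v → u +P negP v) (Ea-top (toℕ<n r) (ℕ.<⇒≤ (toℕ<n c))) (Ea-top (toℕ<n r) (toℕ<n c)))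
               (≡.sym (forwardDiff-< (appendOnes n A) (toℕ<n c))))))

    Ea′-bottomLeft : ∀ {i j} → n ≤ i → j < n → Ea′ i j ≈ 0P
    Ea′-bottomLeft n≤i j<n = ≈-trans (≈-reflexive (≡.trans (forwardDiff-< Ea j<n)
      (cong₂ (λ u v → u +P negP v) (Ea-bottomLeft n≤i (ℕ.<⇒≤ j<n)) (Ea-bottomLeft n≤i j<n)))) (+P-inverseʳ 1P)

    Ea′-complete : ∀ x y → Ea′ (n ℕ.+ x) (n ℕ.+ suc y) ≡ E (n ℕ.+ x) (n ℕ.+ suc y)
    Ea′-complete x y = ≡.trans (forwardDiff-≥ Ea (ℕ.m≤m+n n (suc y))) (setColumn-off (λ _ → 1P) E (n+1+≢n y))

    bottomRight-Ea′ : BidiagonalWithOnesColumn γ (bottomRight n (entries {S} Ea′))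
    bottomRight-Ea′ = record
      { first-column  = λ r → ≈-reflexive (≡.trans (bottomRight-entries n Ea′ r zero)
                          (≡.trans (forwardDiff-≥ Ea (ℕ.m≤m+n n 0)) (setColumn-at (λ _ → 1P) E (ℕ.+-identityʳ n))))
      ; diagonal      = λ { zero r≢0 → ⊥-elim (r≢0 refl)
                          ; (suc r) _ → ≈-trans (≈-reflexive (≡.trans (bottomRight-entries n Ea′ (suc r) (suc r))
                                                  (Ea′-complete (suc (toℕ r)) (toℕ r)))) (E-diagonal (toℕ r)) }
      ; superdiagonal = λ { r zero () ; r (suc c) c≡1+r → ≈-trans (≈-reflexive (≡.trans
                              (bottomRight-entries n Ea′ r (suc c))
                              (≡.trans (Ea′-complete (toℕ r) (toℕ c))
                                       (cong (λ y → E (n ℕ.+ toℕ r) (n ℕ.+ suc y)) (ℕ.suc-injective c≡1+r)))))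
                              (E-superdiagonal (toℕ r)) }
      ; elsewhere     = λ { r zero c≢0 _ _ → ⊥-elim (c≢0 refl)
                          ; r (suc c) _ r≢c c≢1+r → ≈-trans (≈-reflexive (≡.trans
                              (bottomRight-entries n Ea′ r (suc c)) (Ea′-complete (toℕ r) (toℕ c))))
                              (E-elsewhere (r≢c ∘ toℕ-injective) (c≢1+r ∘ cong suc ∘ ≡.sym)) } }

    det-Ea : det (entries {S} Ea) ≈ det (entries {n} (forwardDiff n (appendOnes n A))) *P (suc m · γ ^ m)
    det-Ea = begin
      det (entries {S} Ea)   ≈⟨ det-forwardDiff n Ea n<S ⟨
      det (entries {S} Ea′)  ≈⟨ det-block-lower n (entries Ea′) (λ r c → Ea′-bottomLeft) ⟩
      det (topLeft n (entries {S} Ea′)) *P det (bottomRight n (entries {S} Ea′))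
        ≈⟨ *P-cong det-A′ (det-bidiagonalWithOnesColumn m γ _ bottomRight-Ea′) ⟩
      det (entries {n} (forwardDiff n (appendOnes n A))) *P (suc m · γ ^ m)  ∎

  det-joinEntries : det (entries {n ℕ.+ suc m} J)
    ≈ (det (entries {n} A) *P (γ ^ suc m)) +P (det (entries {n} (forwardDiff n (appendOnes n A))) *P (suc m · γ ^ m))
  det-joinEntries = begin
    det (entries {S} J)                      ≈⟨ det-backwardDiff {S} n J ⟨
    det (entries {S} E)                      ≈⟨ det-linear-column (entries E) (entries Eb) (entries Ea) t
                                                  (λ r c c≢t → ≈-reflexive (≡.sym (setColumn-off γ-at-n E (c≢t ∘ at-t c))))
                                                  (λ r c c≢t → ≈-reflexive (≡.sym (setColumn-off (λ _ → 1P) E (c≢t ∘ at-t c))))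
                                                  (λ r → subst (λ j → E (toℕ r) j ≈ Eb (toℕ r) j +P Ea (toℕ r) j)
                                                               (≡.sym (toℕ-fromℕ< n<S)) (column-n (toℕ r))) ⟩
    det (entries {S} Eb) +P det (entries {S} Ea)  ≈⟨ +P-cong det-Eb det-Ea ⟩
    (det (entries {n} A) *P (γ ^ suc m)) +P (det (entries {n} (forwardDiff n (appendOnes n A))) *P (suc m · γ ^ m))  ∎
    where
    t : Fin S
    t = fromℕ< n<S
    at-t : ∀ c → toℕ c ≡ n → c ≡ t
    at-t c c≡n = toℕ-injective (≡.trans c≡n (≡.sym (toℕ-fromℕ< n<S)))

data Block (k l : ℕ) : Fin (k ℕ.+ l) → Set where
  left  : (x : Fin k) → Block k l (x ↑ˡ l)
  right : (y : Fin l) → Block k l (k ↑ʳ y)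

block : ∀ k l i → Block k l i
block k l i with splitAt k i in eq
... | inj₁ x = subst (Block k l) (splitAt⁻¹-↑ˡ eq) (left x)
... | inj₂ y = subst (Block k l) (splitAt⁻¹-↑ʳ eq) (right y)

module _ (G H : Graph) where

  ⊗-adj-left-left : ∀ x y → adj (G ⊗ H) (x ↑ˡ n H) (y ↑ˡ n H) ≡ adj G x y
  ⊗-adj-left-left x y rewrite splitAt-↑ˡ (n G) x (n H) | splitAt-↑ˡ (n G) y (n H) = refl

  ⊗-adj-left-right : ∀ x y → adj (G ⊗ H) (x ↑ˡ n H) (n G ↑ʳ y) ≡ true
  ⊗-adj-left-right x y rewrite splitAt-↑ˡ (n G) x (n H) | splitAt-↑ʳ (n G) (n H) y = refl

  ⊗-adj-right-left : ∀ x y → adj (G ⊗ H) (n G ↑ʳ x) (y ↑ˡ n H) ≡ true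
  ⊗-adj-right-left x y rewrite splitAt-↑ʳ (n G) (n H) x | splitAt-↑ˡ (n G) y (n H) = refl

  ⊗-adj-right-right : ∀ x y → adj (G ⊗ H) (n G ↑ʳ x) (n G ↑ʳ y) ≡ adj H x y
  ⊗-adj-right-right x y rewrite splitAt-↑ʳ (n G) (n H) x | splitAt-↑ʳ (n G) (n H) y = refl

count-cong : ∀ {k} {f g : Fin k → Bool} → (∀ j → f j ≡ g j) → count f ≡ count g
count-cong {zero}  f≡g = refl
count-cong {suc k} f≡g = cong₂ (λ b c → (if b then 1 else 0) ℕ.+ c) (f≡g zero) (count-cong (f≡g ∘ suc))

count-++ : ∀ k {l} (f : Fin (k ℕ.+ l) → Bool) → count f ≡ count (λ j → f (j ↑ˡ l)) ℕ.+ count (λ j → f (k ↑ʳ j))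
count-++ zero    f = refl
count-++ (suc k) f = ≡.trans (cong ((if f zero then 1 else 0) ℕ.+_) (count-++ k (f ∘ suc)))
                             (≡.sym (ℕ.+-assoc (if f zero then 1 else 0) _ _))

count-true : ∀ k → count {k} (λ _ → true) ≡ k
count-true zero    = refl
count-true (suc k) = cong suc (count-true k)

≟-suc : ∀ {k} (x y : Fin k) → ⌊ Fin.suc x Fin.≟ suc y ⌋ ≡ ⌊ x Fin.≟ y ⌋
≟-suc x y with x Fin.≟ y
... | yes refl = refl
... | no  _    = refl

degree-K : ∀ {k} (x : Fin (suc k)) → degree (K (suc k)) x ≡ k
degree-K {k}     zero    = count-true k
degree-K {suc k} (suc x) = cong suc (≡.trans (count-cong (cong not ∘ ≟-suc x)) (degree-K x))

degree-⊗-left : ∀ G H x → degree (G ⊗ H) (x ↑ˡ n H) ≡ degree G x ℕ.+ n H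
degree-⊗-left G H x = ≡.trans (count-++ (n G) (adj (G ⊗ H) (x ↑ˡ n H)))
  (cong₂ ℕ._+_ (count-cong (⊗-adj-left-left G H x)) (≡.trans (count-cong (⊗-adj-left-right G H x)) (count-true (n H))))

degree-⊗-right : ∀ G H y → degree (G ⊗ H) (n G ↑ʳ y) ≡ n G ℕ.+ degree H y
degree-⊗-right G H y = ≡.trans (count-++ (n G) (adj (G ⊗ H) (n G ↑ʳ y)))
  (cong₂ ℕ._+_ (≡.trans (count-cong (⊗-adj-right-left G H y)) (count-true (n G))) (count-cong (⊗-adj-right-right G H y)))

-- Laplacians of joins with complete graphs

laplacianOf : ∀ {k} → (Fin k → Fin k → Bool) → Fin k → Fin k → ℤ
laplacianOf a i j = if ⌊ i Fin.≟ j ⌋ then + count (a i) else (if a i j then - (+ 1) else + 0)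

-- x·I − L as in Defs, but for a bare adjacency relation: lapCharPoly G is det (charMatrixOf (adj G)).
charMatrixOf : ∀ {k} → (Fin k → Fin k → Bool) → Matrix k
charMatrixOf a i j = if ⌊ i Fin.≟ j ⌋ then (- laplacianOf a i j) ∷ (+ 1) ∷ [] else constP (- laplacianOf a i j)

charEntry : Bool → ℕ → Bool → Poly
charEntry true  d _ = (- (+ d)) ∷ (+ 1) ∷ []
charEntry false _ a = constP (- (if a then - (+ 1) else + 0))

charMatrixOf-entry : ∀ {k} (a : Fin k → Fin k → Bool) i j →
                     charMatrixOf a i j ≡ charEntry ⌊ i Fin.≟ j ⌋ (count (a i)) (a i j)
charMatrixOf-entry a i j with i Fin.≟ j
... | yes _ = refl
... | no  _ = refl

charMatrixOf-cong : ∀ {k} {a b : Fin k → Fin k → Bool} → (∀ i j → a i j ≡ b i j) →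
                    ∀ i j → charMatrixOf a i j ≡ charMatrixOf b i j
charMatrixOf-cong {a = a} {b} a≡b i j = ≡.trans (charMatrixOf-entry a i j)
  (≡.trans (cong₂ (charEntry ⌊ i Fin.≟ j ⌋) (count-cong (a≡b i)) (a≡b i j)) (≡.sym (charMatrixOf-entry b i j)))

det-charMatrixOf-cast : ∀ {k k′} (e : k ≡ k′) (a : Fin k′ → Fin k′ → Bool) →
                        det (charMatrixOf (λ i j → a (cast e i) (cast e j))) ≈ det (charMatrixOf a)
det-charMatrixOf-cast refl a = det-cong λ i j → ≈-reflexive
  (charMatrixOf-cong (λ i j → cong₂ a (cast-is-id refl i) (cast-is-id refl j)) i j)

charEntry-translate : ∀ b d t a → charEntry b (d ℕ.+ t) a ≈ translate (+ t) (charEntry b d a)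
charEntry-translate true  d t a = ≈-sym (≈-trans (translate-monic-linear (+ t) (- (+ d)))
  (∷-cong (≡.sym (≡.trans (cong -_ (ℤ.pos-+ d t)) (ℤ.neg-distrib-+ (+ d) (+ t)))) ≈-refl))
charEntry-translate false d t a = ≈-sym (translate-constP (+ t) _)

vecAt : ∀ {k} → (Fin k → Poly) → ℕ → Poly
vecAt {zero}  v i       = 0P
vecAt {suc k} v zero    = v zero
vecAt {suc k} v (suc i) = vecAt (v ∘ suc) i

vecAt-toℕ : ∀ {k} (v : Fin k → Poly) i → vecAt v (toℕ i) ≡ v i
vecAt-toℕ v zero    = refl
vecAt-toℕ v (suc i) = vecAt-toℕ (v ∘ suc) i

-- Reading a square matrix at natural-number positions (0P outside).
extend : ∀ {k} → Matrix k → ℕ → ℕ → Poly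
extend M i j = vecAt (λ r → vecAt (M r) j) i

extend-toℕ : ∀ {k} (M : Matrix k) r c → extend M (toℕ r) (toℕ c) ≡ M r c
extend-toℕ M r c = ≡.trans (vecAt-toℕ (λ r → vecAt (M r) (toℕ c)) r) (vecAt-toℕ (M r) c)

≟-injective : ∀ {k l} (f : Fin k → Fin l) → (∀ {x y} → f x ≡ f y → x ≡ y) →
              ∀ x y → ⌊ f x Fin.≟ f y ⌋ ≡ ⌊ x Fin.≟ y ⌋
≟-injective f f-injective x y with x Fin.≟ y | f x Fin.≟ f y
... | yes refl | yes _      = refl
... | yes refl | no fx≢fx   = ⊥-elim (fx≢fx refl)
... | no x≢y   | yes fx≡fy  = ⊥-elim (x≢y (f-injective fx≡fy))
... | no _     | no _       = refl

↑ˡ≢↑ʳ : ∀ {k l} (x : Fin k) (y : Fin l) → x ↑ˡ l ≢ k ↑ʳ y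
↑ˡ≢↑ʳ {k} {l} x y eq = ℕ.<⇒≱ (toℕ<n x) (ℕ.≤-trans (ℕ.m≤m+n k (toℕ y))
  (ℕ.≤-reflexive (≡.trans (≡.sym (toℕ-↑ʳ k y)) (≡.trans (cong toℕ (≡.sym eq)) (toℕ-↑ˡ x l)))))

≟-↑ˡ↑ʳ : ∀ {k l} (x : Fin k) (y : Fin l) → ⌊ x ↑ˡ l Fin.≟ k ↑ʳ y ⌋ ≡ false
≟-↑ˡ↑ʳ {k} {l} x y with x ↑ˡ l Fin.≟ k ↑ʳ y
... | yes eq = ⊥-elim (↑ˡ≢↑ʳ x y eq)
... | no  _  = refl

≟-↑ʳ↑ˡ : ∀ {k l} (x : Fin l) (y : Fin k) → ⌊ k ↑ʳ x Fin.≟ y ↑ˡ l ⌋ ≡ false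
≟-↑ʳ↑ˡ {k} {l} x y with k ↑ʳ x Fin.≟ y ↑ˡ l
... | yes eq = ⊥-elim (↑ˡ≢↑ʳ y x (≡.sym eq))
... | no  _  = refl

neg[a+b]≡[1-a]-[1+b] : ∀ a b → - (a +ℤ b) ≡ (- a +ℤ + 1) - (+ 1 +ℤ b)
neg[a+b]≡[1-a]-[1+b] = solve-∀

lapDiffPoly : Graph → Poly
lapDiffPoly G = det (entries {n G} (forwardDiff (n G) (appendOnes (n G) (extend (charMatrixOf (adj G))))))

module _ (G : Graph) (m : ℕ) where
  private
    g = n G
    A = extend (charMatrixOf (adj G))
    γ = x-minus (+ g)
    J = joinEntries g A γ
    GK = G ⊗ K (suc m)
    open JoinEntries g A γ

  -- x·I − L(G × K (1 + m)) is the join block matrix of x·I − L(G) and γ = x − n G, evaluated at x − (1 + m).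
  charMatrix-⊗K : ∀ r c → charMatrixOf (adj GK) r c ≈ translate (+ suc m) (J (toℕ r) (toℕ c))
  charMatrix-⊗K r c with block g (suc m) r | block g (suc m) c
  ... | left x | left y = begin
    charMatrixOf (adj GK) (x ↑ˡ suc m) (y ↑ˡ suc m)
      ≡⟨ ≡.trans (charMatrixOf-entry (adj GK) _ _)
           (≡.trans (cong (λ b → charEntry b (degree GK (x ↑ˡ suc m)) (adj GK (x ↑ˡ suc m) (y ↑ˡ suc m)))
                          (≟-injective (_↑ˡ suc m) (↑ˡ-injective (suc m) _ _) x y))
                    (cong₂ (charEntry _) (degree-⊗-left G (K (suc m)) x) (⊗-adj-left-left G (K (suc m)) x y))) ⟩
    charEntry ⌊ x Fin.≟ y ⌋ (degree G x ℕ.+ suc m) (adj G x y)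
      ≈⟨ charEntry-translate ⌊ x Fin.≟ y ⌋ (degree G x) (suc m) (adj G x y) ⟩
    translate (+ suc m) (charEntry ⌊ x Fin.≟ y ⌋ (degree G x) (adj G x y))
      ≡⟨ cong (translate (+ suc m)) (≡.sym (≡.trans (cong₂ J (toℕ-↑ˡ x (suc m)) (toℕ-↑ˡ y (suc m)))
           (≡.trans (joinEntries-top (toℕ<n x)) (≡.trans (if-yes (toℕ y ℕ.<? g) (toℕ<n y))
           (≡.trans (extend-toℕ (charMatrixOf (adj G)) x y) (charMatrixOf-entry (adj G) x y)))))) ⟩
    translate (+ suc m) (J (toℕ (x ↑ˡ suc m)) (toℕ (y ↑ˡ suc m)))  ∎
  ... | left x | right y = begin
    charMatrixOf (adj GK) (x ↑ˡ suc m) (g ↑ʳ y)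
      ≡⟨ ≡.trans (charMatrixOf-entry (adj GK) _ _)
           (cong₂ (λ b a → charEntry b (degree GK (x ↑ˡ suc m)) a) (≟-↑ˡ↑ʳ x y) (⊗-adj-left-right G (K (suc m)) x y)) ⟩
    1P
      ≈⟨ translate-constP (+ suc m) (+ 1) ⟨
    translate (+ suc m) 1P
      ≡⟨ cong (translate (+ suc m)) (≡.sym (≡.trans (cong₂ J (toℕ-↑ˡ x (suc m)) (toℕ-↑ʳ g y))
           (≡.trans (joinEntries-top (toℕ<n x)) (if-no (g ℕ.+ toℕ y ℕ.<? g) (ℕ.≤⇒≯ (ℕ.m≤m+n g (toℕ y))))))) ⟩
    translate (+ suc m) (J (toℕ (x ↑ˡ suc m)) (toℕ (g ↑ʳ y)))  ∎
  ... | right x | left y = begin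
    charMatrixOf (adj GK) (g ↑ʳ x) (y ↑ˡ suc m)
      ≡⟨ ≡.trans (charMatrixOf-entry (adj GK) _ _)
           (cong₂ (λ b a → charEntry b (degree GK (g ↑ʳ x)) a) (≟-↑ʳ↑ˡ x y) (⊗-adj-right-left G (K (suc m)) x y)) ⟩
    1P
      ≈⟨ translate-constP (+ suc m) (+ 1) ⟨
    translate (+ suc m) 1P
      ≡⟨ cong (translate (+ suc m)) (≡.sym (≡.trans (cong₂ J (toℕ-↑ʳ g x) (toℕ-↑ˡ y (suc m)))
           (joinEntries-bottomLeft (ℕ.m≤m+n g (toℕ x)) (toℕ<n y)))) ⟩
    translate (+ suc m) (J (toℕ (g ↑ʳ x)) (toℕ (y ↑ˡ suc m)))  ∎
  ... | right x | right y = begin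
    charMatrixOf (adj GK) (g ↑ʳ x) (g ↑ʳ y)
      ≡⟨ ≡.trans (charMatrixOf-entry (adj GK) _ _)
           (≡.trans (cong (λ b → charEntry b (degree GK (g ↑ʳ x)) (adj GK (g ↑ʳ x) (g ↑ʳ y)))
                          (≟-injective (g ↑ʳ_) (↑ʳ-injective g _ _) x y))
                    (cong₂ (charEntry _) (≡.trans (degree-⊗-right G (K (suc m)) x) (cong (g ℕ.+_) (degree-K x)))
                                         (⊗-adj-right-right G (K (suc m)) x y))) ⟩
    charEntry ⌊ x Fin.≟ y ⌋ (g ℕ.+ m) (not ⌊ x Fin.≟ y ⌋)
      ≈⟨ complete-block ⟩
    translate (+ suc m) (J (g ℕ.+ toℕ x) (g ℕ.+ toℕ y))
      ≡⟨ cong (translate (+ suc m)) (≡.sym (cong₂ J (toℕ-↑ʳ g x) (toℕ-↑ʳ g y))) ⟩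
    translate (+ suc m) (J (toℕ (g ↑ʳ x)) (toℕ (g ↑ʳ y)))  ∎
    where
    complete-block : charEntry ⌊ x Fin.≟ y ⌋ (g ℕ.+ m) (not ⌊ x Fin.≟ y ⌋)
                   ≈ translate (+ suc m) (J (g ℕ.+ toℕ x) (g ℕ.+ toℕ y))
    complete-block with x Fin.≟ y
    ... | yes refl = ≈-sym (≈-trans (translate-cong (+ suc m) (≈-reflexive (joinEntries-diagonal (toℕ x))))
                       (≈-trans (translate-monic-linear (+ suc m) (- (+ g) +ℤ + 1))
                         (∷-cong (≡.sym (≡.trans (cong -_ (ℤ.pos-+ g m)) (neg[a+b]≡[1-a]-[1+b] (+ g) (+ m)))) ≈-refl)))
    ... | no x≢y   = ≈-sym (≈-trans (translate-cong (+ suc m) (≈-reflexive (joinEntries-offDiagonal (x≢y ∘ toℕ-injective))))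
                                    (translate-constP (+ suc m) (+ 1)))

  lapCharPoly-⊗K : lapCharPoly GK ≈ translate (+ suc m) ((lapCharPoly G *P (γ ^ suc m)) +P (lapDiffPoly G *P (suc m · γ ^ m)))
  lapCharPoly-⊗K = begin
    det (charMatrixOf (adj GK))
      ≈⟨ det-cong charMatrix-⊗K ⟩
    det (λ r c → translate (+ suc m) (entries {g ℕ.+ suc m} J r c))
      ≈⟨ det-homo (translate-isRingHomomorphism (+ suc m)) (entries {g ℕ.+ suc m} J) ⟩
    translate (+ suc m) (det (entries {g ℕ.+ suc m} J))
      ≈⟨ translate-cong (+ suc m) (JoinDeterminant.det-joinEntries g A γ m) ⟩
    translate (+ suc m) ((det (entries {g} A) *P (γ ^ suc m)) +P (lapDiffPoly G *P (suc m · γ ^ m)))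
      ≈⟨ translate-cong (+ suc m) (+P-cong (*P-congˡ (γ ^ suc m)
           (det-cong {g} λ r c → ≈-reflexive (extend-toℕ (charMatrixOf (adj G)) r c))) ≈-refl) ⟩
    translate (+ suc m) ((lapCharPoly G *P (γ ^ suc m)) +P (lapDiffPoly G *P (suc m · γ ^ m)))  ∎

lapCharPoly-⊗K-cong : ∀ G H → n G ≡ n H → lapCharPoly G ≈ lapCharPoly H → lapDiffPoly G ≈ lapDiffPoly H →
                      ∀ m → lapCharPoly (G ⊗ K (suc m)) ≈ lapCharPoly (H ⊗ K (suc m))
lapCharPoly-⊗K-cong G H nG≡nH χ≈ β≈ m = begin
  lapCharPoly (G ⊗ K (suc m))
    ≈⟨ lapCharPoly-⊗K G m ⟩
  translate (+ suc m) ((lapCharPoly G *P (γ (n G) ^ suc m)) +P (lapDiffPoly G *P (suc m · γ (n G) ^ m)))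
    ≡⟨ cong (λ k → translate (+ suc m) ((lapCharPoly G *P (γ k ^ suc m)) +P (lapDiffPoly G *P (suc m · γ k ^ m)))) nG≡nH ⟩
  translate (+ suc m) ((lapCharPoly G *P (γ (n H) ^ suc m)) +P (lapDiffPoly G *P (suc m · γ (n H) ^ m)))
    ≈⟨ translate-cong (+ suc m) (+P-cong (*P-congˡ _ χ≈) (*P-congˡ _ β≈)) ⟩
  translate (+ suc m) ((lapCharPoly H *P (γ (n H) ^ suc m)) +P (lapDiffPoly H *P (suc m · γ (n H) ^ m)))
    ≈⟨ lapCharPoly-⊗K H m ⟨
  lapCharPoly (H ⊗ K (suc m))  ∎
  where
  γ : ℕ → Poly
  γ k = x-minus (+ k)

data Reassoc (g l : ℕ) : Fin ((g ℕ.+ 1) ℕ.+ l) → Set where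
  inG  : (x : Fin g) → Reassoc g l ((x ↑ˡ 1) ↑ˡ l)
  apex : Reassoc g l ((g ↑ʳ zero) ↑ˡ l)
  inK  : (y : Fin l) → Reassoc g l ((g ℕ.+ 1) ↑ʳ y)

reassoc : ∀ g l i → Reassoc g l i
reassoc g l i with block (g ℕ.+ 1) l i
reassoc g l .(x ↑ˡ l) | left x with block g 1 x
... | left x′     = inG x′
... | right zero  = apex
reassoc g l .((g ℕ.+ 1) ↑ʳ y) | right y = inK y

-- (G ⊗ K 1) ⊗ K l is G ⊗ K (1 + l), up to reading Fin ((g + 1) + l) as Fin (g + (1 + l)).
module _ (G : Graph) (l : ℕ) where
  private
    g = n G
    e : (g ℕ.+ 1) ℕ.+ l ≡ g ℕ.+ suc l
    e = ℕ.+-assoc g 1 l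
    reindex : Fin ((g ℕ.+ 1) ℕ.+ l) → Fin (g ℕ.+ suc l)
    reindex = cast e

    reindex-inG : ∀ x → reindex ((x ↑ˡ 1) ↑ˡ l) ≡ x ↑ˡ suc l
    reindex-inG x = toℕ-injective (≡.trans (toℕ-cast e _)
      (≡.trans (toℕ-↑ˡ (x ↑ˡ 1) l) (≡.trans (toℕ-↑ˡ x 1) (≡.sym (toℕ-↑ˡ x (suc l))))))

    reindex-apex : reindex ((g ↑ʳ zero) ↑ˡ l) ≡ g ↑ʳ zero
    reindex-apex = toℕ-injective (≡.trans (toℕ-cast e _)
      (≡.trans (toℕ-↑ˡ (g ↑ʳ zero) l) (≡.trans (toℕ-↑ʳ g zero) (≡.sym (toℕ-↑ʳ g zero)))))

    reindex-inK : ∀ y → reindex ((g ℕ.+ 1) ↑ʳ y) ≡ g ↑ʳ suc y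
    reindex-inK y = toℕ-injective (≡.trans (toℕ-cast e _)
      (≡.trans (toℕ-↑ʳ (g ℕ.+ 1) y) (≡.trans (ℕ.+-assoc g 1 (toℕ y)) (≡.sym (toℕ-↑ʳ g (suc y))))))

    G₁ GK₁ GK : Graph
    G₁  = G ⊗ K 1
    GK₁ = G₁ ⊗ K l
    GK  = G ⊗ K (suc l)

  ⊗K-reassoc-adj : ∀ i j → adj GK₁ i j ≡ adj GK (reindex i) (reindex j)
  ⊗K-reassoc-adj i j with reassoc g l i | reassoc g l j
  ... | inG x | inG y = ≡.trans (≡.trans (⊗-adj-left-left G₁ (K l) (x ↑ˡ 1) (y ↑ˡ 1)) (⊗-adj-left-left G (K 1) x y))
                                (≡.sym (≡.trans (cong₂ (adj GK) (reindex-inG x) (reindex-inG y)) (⊗-adj-left-left G (K (suc l)) x y)))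
  ... | inG x | apex  = ≡.trans (≡.trans (⊗-adj-left-left G₁ (K l) (x ↑ˡ 1) (g ↑ʳ zero)) (⊗-adj-left-right G (K 1) x zero))
                                (≡.sym (≡.trans (cong₂ (adj GK) (reindex-inG x) reindex-apex) (⊗-adj-left-right G (K (suc l)) x zero)))
  ... | inG x | inK y = ≡.trans (⊗-adj-left-right G₁ (K l) (x ↑ˡ 1) y)
                                (≡.sym (≡.trans (cong₂ (adj GK) (reindex-inG x) (reindex-inK y)) (⊗-adj-left-right G (K (suc l)) x (suc y))))
  ... | apex  | inG y = ≡.trans (≡.trans (⊗-adj-left-left G₁ (K l) (g ↑ʳ zero) (y ↑ˡ 1)) (⊗-adj-right-left G (K 1) zero y))
                                (≡.sym (≡.trans (cong₂ (adj GK) reindex-apex (reindex-inG y)) (⊗-adj-right-left G (K (suc l)) zero y)))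
  ... | apex  | apex  = ≡.trans (≡.trans (⊗-adj-left-left G₁ (K l) (g ↑ʳ zero) (g ↑ʳ zero)) (⊗-adj-right-right G (K 1) zero zero))
                                (≡.sym (≡.trans (cong₂ (adj GK) reindex-apex reindex-apex) (⊗-adj-right-right G (K (suc l)) zero zero)))
  ... | apex  | inK y = ≡.trans (⊗-adj-left-right G₁ (K l) (g ↑ʳ zero) y)
                                (≡.sym (≡.trans (cong₂ (adj GK) reindex-apex (reindex-inK y)) (⊗-adj-right-right G (K (suc l)) zero (suc y))))
  ... | inK x | inG y = ≡.trans (⊗-adj-right-left G₁ (K l) x (y ↑ˡ 1))
                                (≡.sym (≡.trans (cong₂ (adj GK) (reindex-inK x) (reindex-inG y)) (⊗-adj-right-left G (K (suc l)) (suc x) y)))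
  ... | inK x | apex  = ≡.trans (⊗-adj-right-left G₁ (K l) x (g ↑ʳ zero))
                                (≡.sym (≡.trans (cong₂ (adj GK) (reindex-inK x) reindex-apex) (⊗-adj-right-right G (K (suc l)) (suc x) zero)))
  ... | inK x | inK y = ≡.trans (⊗-adj-right-right G₁ (K l) x y)
                                (≡.sym (≡.trans (cong₂ (adj GK) (reindex-inK x) (reindex-inK y))
                                                (≡.trans (⊗-adj-right-right G (K (suc l)) (suc x) (suc y)) (cong not (≟-suc x y)))))

  lapCharPoly-⊗K-reassoc : lapCharPoly GK₁ ≈ lapCharPoly GK
  lapCharPoly-⊗K-reassoc = ≈-trans (det-cong λ i j → ≈-reflexive (charMatrixOf-cong ⊗K-reassoc-adj i j))
                                   (det-charMatrixOf-cast e (adj GK))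

-- Θ₃,₂,₅ and H₂

lapCharPoly-Θ⊗K₁≈H₂ : lapCharPoly (Θ325 ⊗ K 1) ≈ lapCharPoly H2
lapCharPoly-Θ⊗K₁≈H₂ = ==P-sound _ _ refl

lapDiffPoly-Θ⊗K₁≈H₂ : lapDiffPoly (Θ325 ⊗ K 1) ≈ lapDiffPoly H2
lapDiffPoly-Θ⊗K₁≈H₂ = ==P-sound _ _ refl

Θ⊗K[1+m]≈H₂⊗K[m] : ∀ m → lapCharPoly (Θ325 ⊗ K (suc m)) ≈ lapCharPoly (H2 ⊗ K m)
Θ⊗K[1+m]≈H₂⊗K[m] zero    = ==P-sound _ _ refl
Θ⊗K[1+m]≈H₂⊗K[m] (suc m) = begin
  lapCharPoly (Θ325 ⊗ K (suc (suc m)))     ≈⟨ lapCharPoly-⊗K-reassoc Θ325 (suc m) ⟨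
  lapCharPoly ((Θ325 ⊗ K 1) ⊗ K (suc m))  ≈⟨ lapCharPoly-⊗K-cong (Θ325 ⊗ K 1) H2 refl
                                                lapCharPoly-Θ⊗K₁≈H₂ lapDiffPoly-Θ⊗K₁≈H₂ m ⟩
  lapCharPoly (H2 ⊗ K (suc m))             ∎

mainTheorem13 : (m : ℕ) → 1 ≤ m →
    LaplacianCospectral (Θ325 ⊗ K m) (H2 ⊗ K (m ∸ 1))
mainTheorem13 (suc m) _ = refl , coeff-≡ (Θ⊗K[1+m]≈H₂⊗K[m] m)
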